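{- Let $a,b,c$ be positive integers. For all non-negative integers $m,n$, in the algebra $(\mathfrak{H}^1,*)$, \[d(z_c^m z_b z_a^n)=\sum_{k=0}^m\sum_{l=0}^n(-1)^{k+l}\,(z_a^l z_b z_c^k)*d(z_c^{m-k})*d(z_a^{n-l}).\]
   Context: $\mathfrak{H}=\mathbb{Q}\langle x,y\rangle$ is the non-commutative polynomial algebra in two indeterminates, and $\mathfrak{H}^1=\mathbb{Q}+\mathfrak{H}y$. For $k\ge1$ put $z_k=x^{k-1}y$. Let $\gamma$ be the algebra automorphism of $\mathfrak{H}$ with $\gamma(x)=x$, $\gamma(y)=x+y$, and let $d:\mathfrak{H}^1\to\mathfrak{H}^1$ be the $\mathbb{Q}$-linear map with $d(1)=1$ and $d(wy)=\gamma(w)y$ for every word $w\in\mathfrak{H}$. The harmonic product $*$ is the $\mathbb{Q}$-bilinear product on $\mathfrak{H}^1$ defined inductively by $1*w=w*1=w$ and $z_kw*z_lw'=z_k(w*z_lw')+z_l(z_kw*w')+z_{k+l}(w*w')$ for $k,l\ge1$ and $w,w'\in\mathfrak{H}^1$; it makes $\mathfrak{H}^1$ a commutative associative $\mathbb{Q}$-algebra. Powers $z_a^n$ are concatenation powers (with $z_a^0=1$). -}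

module Defs where

open import Data.Nat as ℕ using (ℕ; zero; suc; _∸_)
open import Data.Rational as ℚ using (ℚ; 0ℚ; 1ℚ)
open import Data.List using (List; []; _∷_; _++_; [_]; replicate; concat; concatMap; map; upTo)
open import Data.List.Properties using (≡-dec)
open import Data.Maybe using (Maybe; just; nothing)
open import Data.Product using (_×_; _,_)
open import Relation.Binary.PropositionalEquality using (_≡_; refl)
open import Relation.Nullary using (yes; no; Dec)

-- Words in the two letters x, y  (monomials of ℌ = ℚ⟨x,y⟩)

data Letter : Set where
  x y : Letter

_≟L_ : (a b : Letter) → Dec (a ≡ b)
x ≟L x = yes refl
x ≟L y = no λ ()
y ≟L x = no λ ()
y ≟L y = yes refl

Word : Set
Word = List Letter

_≟W_ : (u v : Word) → Dec (u ≡ v)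
_≟W_ = ≡-dec _≟L_

-- Elements of ℌ: finite formal ℚ-linear combinations of words.
-- Two representations denote the same element iff all coefficients agree.

Poly : Set
Poly = List (ℚ × Word)

coeff : Poly → Word → ℚ
coeff [] w = 0ℚ
coeff ((q , u) ∷ p) w with u ≟W w
... | yes _ = q ℚ.+ coeff p w
... | no  _ = coeff p w

_≈_ : Poly → Poly → Set
p ≈ p' = ∀ w → coeff p w ≡ coeff p' w

infix 4 _≈_

zeroP : Poly
zeroP = []

oneP : Poly
oneP = (1ℚ , []) ∷ []

word : Word → Poly
word w = (1ℚ , w) ∷ []

infixl 6 _⊕_
_⊕_ : Poly → Poly → Poly
_⊕_ = _++_

scale : ℚ → Poly → Poly
scale q p = map (λ { (r , u) → (q ℚ.* r , u) }) p

infixl 7 _·_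
_·_ : Poly → Poly → Poly
p · p' = concatMap (λ { (r , u) → map (λ { (s , v) → (r ℚ.* s , u ++ v) }) p' }) p

sumP : List Poly → Poly
sumP = concat

z : ℕ → Word
z k = replicate (k ∸ 1) x ++ [ y ]

_^W_ : Word → ℕ → Word
w ^W zero  = []
w ^W suc n = w ++ (w ^W n)

γL : Letter → Poly
γL x = word [ x ]
γL y = word [ x ] ⊕ word [ y ]

γW : Word → Poly
γW []      = oneP
γW (l ∷ w) = γL l · γW w

-- d : ℌ¹ → ℌ¹,  d(1) = 1,  d(w y) = γ(w) y.
-- (On words ending in x, which are not in ℌ¹, we put 0; d is never
-- applied to such words below.)

dAux : Letter → Word → Poly
dAux x []       = zeroP
dAux y []       = word [ y ]
dAux l (l' ∷ w) = γL l · dAux l' w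

dW : Word → Poly
dW []      = oneP
dW (l ∷ w) = dAux l w

d : Poly → Poly
d p = concatMap (λ { (r , u) → scale r (dW u) }) p

-- Harmonic product.
-- A word of ℌ¹ is uniquely a product z_{k₁}⋯z_{k_r}; we encode it by the
-- list of indices (k₁ - 1, …, k_r - 1).

ZWord : Set
ZWord = List ℕ

toWord : ZWord → Word
toWord []      = []
toWord (j ∷ u) = z (suc j) ++ toWord u

-- parse a word of ℌ into z-blocks; `nothing` iff the word is not in ℌ¹
parseAux : ℕ → Word → Maybe ZWord
parseAux zero    []      = just []
parseAux (suc n) []      = nothing
parseAux n       (x ∷ w) = parseAux (suc n) w
parseAux n       (y ∷ w) with parseAux zero w
... | just u  = just (n ∷ u)
... | nothing = nothing

parse : Word → Maybe ZWord
parse = parseAux zero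

ZPoly : Set
ZPoly = List (ℚ × ZWord)

consZ : ℕ → ZPoly → ZPoly
consZ j p = map (λ { (r , u) → (r , j ∷ u) }) p

-- z_k w * z_l w' = z_k (w * z_l w') + z_l (z_k w * w') + z_{k+l} (w * w')
-- index j encodes z_{j+1}, so z_{k+l} is encoded by (k-1)+(l-1)+1.
harmZ : ZWord → ZWord → ZPoly
harmZ []      v       = (1ℚ , v) ∷ []
harmZ (a ∷ u) []      = (1ℚ , a ∷ u) ∷ []
harmZ (a ∷ u) (b ∷ v) =
  consZ a (harmZ u (b ∷ v)) ++
  (consZ b (harmZ (a ∷ u) v) ++
   consZ (suc (a ℕ.+ b)) (harmZ u v))

fromZPoly : ZPoly → Poly
fromZPoly p = map (λ { (r , u) → (r , toWord u) }) p

harmW : Word → Word → Poly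
harmW u v with parse u | parse v
... | just u' | just v' = fromZPoly (harmZ u' v')
... | _       | _       = zeroP   -- not in ℌ¹; never used

infixl 7 _✱_
_✱_ : Poly → Poly → Poly
p ✱ p' = concatMap (λ { (r , u) → concatMap (λ { (s , v) → scale (r ℚ.* s) (harmW u v) }) p' }) p

sgn : ℕ → ℚ
sgn zero    = 1ℚ
sgn (suc n) = ℚ.- sgn n

Σ≤ : ℕ → (ℕ → Poly) → Poly
Σ≤ m f = sumP (map f (upTo (suc m)))

module Submission where

open import Defs
open import Data.Nat using (ℕ; _≤_; _∸_; _+_)
open import Data.List using (_++_)

open import Data.Nat as ℕ using (zero; suc; s≤s; z≤n)
import Data.Nat.Properties as ℕP
open import Data.Rational as ℚ using (ℚ; 0ℚ; 1ℚ)
import Data.Rational.Properties as ℚP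
open import Data.List as List using (List; []; _∷_; map; length; replicate)
import Data.List.Properties as ListP
open import Data.Product using (_×_; _,_; proj₁; proj₂)
open import Data.Maybe using (just)
open import Data.Empty using (⊥-elim)
open import Relation.Nullary using (yes; no; ¬_)
open import Relation.Binary.Definitions using (DecidableEquality)
open import Relation.Binary.Bundles using (Setoid)
open import Relation.Binary.PropositionalEquality
  using (_≡_; _≢_; refl; sym; trans; cong; cong₂)
open import Algebra.Bundles using (CommutativeMonoid)
import Algebra.Solver.CommutativeMonoid as CMSolver
import Relation.Binary.Reasoning.Setoid

-- Words of ℌ¹ are handled in the block encoding of Defs (z_{j+1} ↦ j), in which the
-- harmonic product and d are plain recursions.

Lin : Set → Set
Lin K = List (ℚ × K)

infixr 7 _•_
_•_ : {K : Set} → ℚ → Lin K → Lin K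
r • p = map (λ t → (r ℚ.* proj₁ t , proj₂ t)) p

neg : {K : Set} → Lin K → Lin K
neg = (ℚ.- 1ℚ) •_

single : {K : Set} → K → Lin K
single u = (1ℚ , u) ∷ []

extend : {K K' : Set} → (K → Lin K') → Lin K → Lin K'
extend f []            = []
extend f ((r , u) ∷ p) = r • f u ++ extend f p

extend-++ : {K K' : Set} (f : K → Lin K') (p q : Lin K) →
            extend f (p ++ q) ≡ extend f p ++ extend f q
extend-++ f []            q = refl
extend-++ f ((r , u) ∷ p) q =
  trans (cong (r • f u ++_) (extend-++ f p q)) (sym (ListP.++-assoc (r • f u) _ _))

extend-++₃ : {K K' : Set} (f : K → Lin K') (p q r : Lin K) →
             extend f (p ++ (q ++ r)) ≡ extend f p ++ (extend f q ++ extend f r)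
extend-++₃ f p q r = trans (extend-++ f p (q ++ r)) (cong (extend f p ++_) (extend-++ f q r))

•-++ : {K : Set} (r : ℚ) (p q : Lin K) → r • (p ++ q) ≡ r • p ++ r • q
•-++ r = ListP.map-++ _

module Coefficients {K : Set} (_≟_ : DecidableEquality K) where

  coeffOf : Lin K → K → ℚ
  coeffOf []            w = 0ℚ
  coeffOf ((q , u) ∷ p) w with u ≟ w
  ... | yes _ = q ℚ.+ coeffOf p w
  ... | no  _ = coeffOf p w

  infix 4 _≋_
  record _≋_ (p q : Lin K) : Set where
    constructor coeffwise
    field coeffwise-eq : ∀ w → coeffOf p w ≡ coeffOf q w
  open _≋_ public

  coeff-++ : ∀ p q w → coeffOf (p ++ q) w ≡ coeffOf p w ℚ.+ coeffOf q w
  coeff-++ []            q w = sym (ℚP.+-identityˡ _)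
  coeff-++ ((r , u) ∷ p) q w with u ≟ w
  ... | yes _ = trans (cong (r ℚ.+_) (coeff-++ p q w)) (sym (ℚP.+-assoc r _ _))
  ... | no  _ = coeff-++ p q w

  coeff-• : ∀ r p w → coeffOf (r • p) w ≡ r ℚ.* coeffOf p w
  coeff-• r []            w = sym (ℚP.*-zeroʳ r)
  coeff-• r ((s , u) ∷ p) w with u ≟ w
  ... | yes _ = trans (cong (r ℚ.* s ℚ.+_) (coeff-• r p w)) (sym (ℚP.*-distribˡ-+ r s _))
  ... | no  _ = coeff-• r p w

  ≋-refl : ∀ {p} → p ≋ p
  ≋-refl = coeffwise λ _ → refl

  ≋-sym : ∀ {p q} → p ≋ q → q ≋ p
  ≋-sym e = coeffwise λ w → sym (coeffwise-eq e w)

  ≋-trans : ∀ {p q s} → p ≋ q → q ≋ s → p ≋ s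
  ≋-trans e f = coeffwise λ w → trans (coeffwise-eq e w) (coeffwise-eq f w)

  ≡⇒≋ : ∀ {p q} → p ≡ q → p ≋ q
  ≡⇒≋ refl = ≋-refl

  ≋-setoid : Setoid _ _
  ≋-setoid = record
    { Carrier = Lin K ; _≈_ = _≋_
    ; isEquivalence = record { refl = ≋-refl ; sym = ≋-sym ; trans = ≋-trans } }

  lift₂ : ∀ p q s t →
          (∀ w → coeffOf p w ℚ.+ coeffOf q w ≡ coeffOf s w ℚ.+ coeffOf t w) →
          p ++ q ≋ s ++ t
  lift₂ p q s t h = coeffwise λ w →
    trans (coeff-++ p q w) (trans (h w) (sym (coeff-++ s t w)))

  ++-cong : ∀ {p p' q q'} → p ≋ p' → q ≋ q' → p ++ q ≋ p' ++ q'
  ++-cong {p} {p'} {q} {q'} e f = lift₂ p q p' q' λ w → cong₂ ℚ._+_ (coeffwise-eq e w) (coeffwise-eq f w)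

  ++-comm : ∀ p q → p ++ q ≋ q ++ p
  ++-comm p q = lift₂ p q q p λ w → ℚP.+-comm (coeffOf p w) (coeffOf q w)

  commutativeMonoid : CommutativeMonoid _ _
  commutativeMonoid = record
    { Carrier = Lin K ; _≈_ = _≋_ ; _∙_ = _++_ ; ε = []
    ; isCommutativeMonoid = record
      { isMonoid = record
        { isSemigroup = record
          { isMagma = record
            { isEquivalence = Setoid.isEquivalence ≋-setoid ; ∙-cong = ++-cong }
          ; assoc = λ p q s → ≡⇒≋ (ListP.++-assoc p q s) }
        ; identity = (λ _ → ≋-refl) , (λ p → ≡⇒≋ (ListP.++-identityʳ p)) }
      ; comm = ++-comm } }

  module ≋-Reasoning = Relation.Binary.Reasoning.Setoid ≋-setoid

  open CMSolver commutativeMonoid public using (solve; _⊜_) renaming (_⊕_ to _⊞_)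

  ++-assoc : ∀ p q s → (p ++ q) ++ s ≋ p ++ (q ++ s)
  ++-assoc p q s = ≡⇒≋ (ListP.++-assoc p q s)

  ++-identityʳ : ∀ p → p ++ [] ≋ p
  ++-identityʳ p = ≡⇒≋ (ListP.++-identityʳ p)

  ++-zeroˡ : ∀ {p q} → p ≋ [] → p ++ q ≋ q
  ++-zeroˡ {q = q} e = ++-cong e (≋-refl {q})

  ++-congˡ : ∀ p {q q'} → q ≋ q' → p ++ q ≋ p ++ q'
  ++-congˡ p = ++-cong (≋-refl {p})

  ++-congʳ : ∀ q {p p'} → p ≋ p' → p ++ q ≋ p' ++ q
  ++-congʳ q e = ++-cong e (≋-refl {q})

  interchange : ∀ p q s t → (p ++ q) ++ (s ++ t) ≋ (p ++ s) ++ (q ++ t)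
  interchange = solve 4 (λ p q s t → (p ⊞ q) ⊞ (s ⊞ t) ⊜ (p ⊞ s) ⊞ (q ⊞ t)) ≋-refl

  swap-front : ∀ p q s → p ++ (q ++ s) ≋ q ++ (p ++ s)
  swap-front = solve 3 (λ p q s → p ⊞ (q ⊞ s) ⊜ q ⊞ (p ⊞ s)) ≋-refl

  •-cong : ∀ r {p q} → p ≋ q → r • p ≋ r • q
  •-cong r {p} {q} e = coeffwise λ w →
    trans (coeff-• r p w) (trans (cong (r ℚ.*_) (coeffwise-eq e w)) (sym (coeff-• r q w)))

  •-• : ∀ r s p → r • (s • p) ≋ (r ℚ.* s) • p
  •-• r s p = coeffwise λ w → trans (coeff-• r (s • p) w)
    (trans (cong (r ℚ.*_) (coeff-• s p w))
    (trans (sym (ℚP.*-assoc r s _)) (sym (coeff-• (r ℚ.* s) p w))))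

  1• : ∀ p → 1ℚ • p ≋ p
  1• p = coeffwise λ w → trans (coeff-• 1ℚ p w) (ℚP.*-identityˡ _)

  0• : ∀ p → 0ℚ • p ≋ []
  0• p = coeffwise λ w → trans (coeff-• 0ℚ p w) (ℚP.*-zeroˡ (coeffOf p w))

  +• : ∀ r s p → (r ℚ.+ s) • p ≋ r • p ++ s • p
  +• r s p = coeffwise λ w → trans (coeff-• (r ℚ.+ s) p w)
    (trans (ℚP.*-distribʳ-+ _ r s)
    (sym (trans (coeff-++ (r • p) (s • p) w) (cong₂ ℚ._+_ (coeff-• r p w) (coeff-• s p w)))))

  •-comm : ∀ r s p → r • (s • p) ≋ s • (r • p)
  •-comm r s p = ≋-trans (•-• r s p)
    (≋-trans (≡⇒≋ (cong (_• p) (ℚP.*-comm r s))) (≋-sym (•-• s r p)))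

  neg-cancel : ∀ p → p ++ neg p ≋ []
  neg-cancel p = coeffwise λ w → cancel (coeffOf p w) (coeff-++ p (neg p) w) (coeff-• (ℚ.- 1ℚ) p w)
    where
    cancel : ∀ c {s t} → s ≡ c ℚ.+ t → t ≡ ℚ.- 1ℚ ℚ.* c → s ≡ 0ℚ
    cancel c refl refl = trans (cong (c ℚ.+_) (trans (sym (ℚP.neg-distribˡ-* 1ℚ c))
                                                      (cong ℚ.-_ (ℚP.*-identityˡ c))))
                               (ℚP.+-inverseʳ c)

  difference-zero : ∀ p q → p ++ neg q ≋ [] → p ≋ q
  difference-zero p q e = begin
    p                       ≈⟨ ≋-sym (++-identityʳ p) ⟩
    p ++ []                 ≈⟨ ++-congˡ p (≋-sym (≋-trans (++-comm (neg q) q) (neg-cancel q))) ⟩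
    p ++ (neg q ++ q)       ≈⟨ ≋-sym (++-assoc p (neg q) q) ⟩
    (p ++ neg q) ++ q       ≈⟨ ++-zeroˡ e ⟩
    q                       ∎
    where open ≋-Reasoning

  cancelʳ : ∀ p q s → p ++ s ≋ q ++ s → p ≋ q
  cancelʳ p q s e = difference-zero p q (begin
    p ++ neg q                    ≈⟨ ≋-sym (++-identityʳ _) ⟩
    (p ++ neg q) ++ []            ≈⟨ ++-congˡ (p ++ neg q) (≋-sym (neg-cancel s)) ⟩
    (p ++ neg q) ++ (s ++ neg s)  ≈⟨ interchange p (neg q) s (neg s) ⟩
    (p ++ s) ++ (neg q ++ neg s)  ≈⟨ ++-cong e (≡⇒≋ (sym (•-++ (ℚ.- 1ℚ) q s))) ⟩
    (q ++ s) ++ neg (q ++ s)      ≈⟨ neg-cancel (q ++ s) ⟩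
    []                            ∎)
    where open ≋-Reasoning

  remove : K → Lin K → Lin K
  remove u [] = []
  remove u ((r , v) ∷ q) with v ≟ u
  ... | yes _ = remove u q
  ... | no  _ = (r , v) ∷ remove u q

  remove-length : ∀ u q → length (remove u q) ℕ.≤ length q
  remove-length u [] = z≤n
  remove-length u ((r , v) ∷ q) with v ≟ u
  ... | yes _ = ℕP.m≤n⇒m≤1+n (remove-length u q)
  ... | no  _ = s≤s (remove-length u q)

  coeff-remove-same : ∀ u q → coeffOf (remove u q) u ≡ 0ℚ
  coeff-remove-same u [] = refl
  coeff-remove-same u ((r , v) ∷ q) with v ≟ u
  ... | yes _ = coeff-remove-same u q
  ... | no v≢u with v ≟ u
  ...   | yes v≡u = ⊥-elim (v≢u v≡u)
  ...   | no  _   = coeff-remove-same u q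

  coeff-remove-other : ∀ u q w → ¬ u ≡ w → coeffOf (remove u q) w ≡ coeffOf q w
  coeff-remove-other u [] w _ = refl
  coeff-remove-other u ((r , v) ∷ q) w u≢w with v ≟ u
  ... | yes refl with v ≟ w
  ...   | yes refl = ⊥-elim (u≢w refl)
  ...   | no  _    = coeff-remove-other u q w u≢w
  coeff-remove-other u ((r , v) ∷ q) w u≢w | no _ with v ≟ w
  ...   | yes _ = cong (r ℚ.+_) (coeff-remove-other u q w u≢w)
  ...   | no  _ = coeff-remove-other u q w u≢w

  ∷-cong : ∀ {r r'} u {p p'} → r ≡ r' → p ≋ p' → (r , u) ∷ p ≋ (r' , u) ∷ p'
  ∷-cong {r} {r'} u {p} {p'} r≡r' e = coeffwise eq
    where
    eq : ∀ w → coeffOf ((r , u) ∷ p) w ≡ coeffOf ((r' , u) ∷ p') w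
    eq w with u ≟ w
    ... | yes _ = cong₂ ℚ._+_ r≡r' (coeffwise-eq e w)
    ... | no  _ = coeffwise-eq e w

  extend-single-unit : ∀ p → extend single p ≋ p
  extend-single-unit []            = ≋-refl
  extend-single-unit ((r , u) ∷ p) = ∷-cong u (ℚP.*-identityʳ r) (extend-single-unit p)

module Extension {K K' : Set} (_≟'_ : DecidableEquality K') where
  open Coefficients _≟'_

  extend-cong : ∀ {f g : K → Lin K'} p → (∀ u → f u ≋ g u) → extend f p ≋ extend g p
  extend-cong []            e = ≋-refl
  extend-cong ((r , u) ∷ p) e = ++-cong (•-cong r (e u)) (extend-cong p e)

  extend-• : ∀ (f : K → Lin K') r p → extend f (r • p) ≋ r • extend f p
  extend-• f r []            = ≋-refl
  extend-• f r ((s , u) ∷ p) =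
    ≋-trans (++-cong (≋-sym (•-• r s (f u))) (extend-• f r p))
            (≡⇒≋ (sym (•-++ r (s • f u) (extend f p))))

  extend-neg : ∀ (f : K → Lin K') p → extend f (neg p) ≋ neg (extend f p)
  extend-neg f = extend-• f (ℚ.- 1ℚ)

  extend-pointwise-++ : ∀ (f g : K → Lin K') p →
                        extend (λ u → f u ++ g u) p ≋ extend f p ++ extend g p
  extend-pointwise-++ f g []            = ≋-refl
  extend-pointwise-++ f g ((r , u) ∷ p) =
    ≋-trans (++-cong (≡⇒≋ (•-++ r (f u) (g u))) (extend-pointwise-++ f g p))
            (interchange (r • f u) (r • g u) (extend f p) (extend g p))

  extend-pointwise-• : ∀ (f : K → Lin K') r p → extend (λ u → r • f u) p ≋ r • extend f p
  extend-pointwise-• f r []            = ≋-refl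
  extend-pointwise-• f r ((s , u) ∷ p) =
    ≋-trans (++-cong (•-comm s r (f u)) (extend-pointwise-• f r p))
            (≡⇒≋ (sym (•-++ r (s • f u) (extend f p))))

  extend-pointwise-zero : ∀ p → extend {K} {K'} (λ _ → []) p ≋ []
  extend-pointwise-zero []            = ≋-refl
  extend-pointwise-zero ((r , u) ∷ p) = extend-pointwise-zero p

  extend-single : ∀ (f : K → Lin K') u → extend f (single u) ≋ f u
  extend-single f u = ≋-trans (++-identityʳ _) (1• (f u))

module Respect {K K' : Set} (_≟_ : DecidableEquality K) (_≟'_ : DecidableEquality K') where
  module C₀ = Coefficients _≟_
  open C₀ using (remove) renaming (_≋_ to _≋₀_)
  open Coefficients _≟'_ hiding (remove)
  open Extension {K} {K'} _≟'_

  extend-split : ∀ (f : K → Lin K') u q →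
                 extend f q ≋ C₀.coeffOf q u • f u ++ extend f (remove u q)
  extend-split f u [] = ≋-sym (++-zeroˡ (0• (f u)))
  extend-split f u ((r , v) ∷ q) with v ≟ u
  ... | yes refl = ≋-trans (++-congˡ (r • f v) (extend-split f u q))
          (≋-trans (≋-sym (++-assoc (r • f v) _ _)) (++-congʳ _ (≋-sym (+• r _ (f u)))))
  ... | no _ = ≋-trans (++-congˡ (r • f v) (extend-split f u q))
          (swap-front (r • f v) (C₀.coeffOf q u • f u) (extend f (remove u q)))

  extend-null : ∀ (f : K → Lin K') n q → length q ℕ.≤ n → q ≋₀ [] → extend f q ≋ []
  extend-null f n [] _ _ = ≋-refl
  extend-null f (suc n) ((r , u) ∷ q) (s≤s len≤n) q≋0 =
    ≋-trans (extend-split f u ((r , u) ∷ q))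
    (≋-trans (++-zeroˡ (≋-trans (≡⇒≋ (cong (_• f u) (C₀.coeffwise-eq q≋0 u))) (0• (f u))))
             (extend-null f n (remove u ((r , u) ∷ q)) shorter (C₀.coeffwise rest≋0)))
    where
    remove-head : remove u ((r , u) ∷ q) ≡ remove u q
    remove-head with u ≟ u
    ... | yes _ = refl
    ... | no u≢u = ⊥-elim (u≢u refl)

    shorter : length (remove u ((r , u) ∷ q)) ℕ.≤ n
    shorter rewrite remove-head = ℕP.≤-trans (C₀.remove-length u q) len≤n

    rest≋0 : ∀ w → C₀.coeffOf (remove u ((r , u) ∷ q)) w ≡ 0ℚ
    rest≋0 w with u ≟ w
    ... | yes refl = C₀.coeff-remove-same u ((r , u) ∷ q)
    ... | no u≢w = trans (C₀.coeff-remove-other u ((r , u) ∷ q) w u≢w) (C₀.coeffwise-eq q≋0 w)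

  extend-resp : ∀ (f : K → Lin K') {p q} → p ≋₀ q → extend f p ≋ extend f q
  extend-resp f {p} {q} p≋q = difference-zero (extend f p) (extend f q)
    (≋-trans (≋-sym (≋-trans (≡⇒≋ (extend-++ f p (neg q))) (++-congˡ (extend f p) (extend-neg f q))))
             (extend-null f _ (p ++ neg q) ℕP.≤-refl difference≋0))
    where
    difference≋0 : p ++ neg q ≋₀ []
    difference≋0 = C₀.≋-trans (C₀.++-congʳ (neg q) p≋q) (C₀.neg-cancel q)

module Composition {K K' K'' : Set} (_≟''_ : DecidableEquality K'') where
  open Coefficients _≟''_

  extend-extend : ∀ (f : K → Lin K') (g : K' → Lin K'') p →
                  extend g (extend f p) ≋ extend (λ u → extend g (f u)) p
  extend-extend f g []            = ≋-refl
  extend-extend f g ((r , u) ∷ p) =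
    ≋-trans (≡⇒≋ (extend-++ g (r • f u) (extend f p)))
            (++-cong (Extension.extend-• _≟''_ g r (f u)) (extend-extend f g p))

  extend-interchange : ∀ (h : K → K' → Lin K'') p q →
    extend (λ u → extend (h u) q) p ≋ extend (λ v → extend (λ u → h u v) p) q
  extend-interchange h []            q = ≋-sym (Extension.extend-pointwise-zero _≟''_ q)
  extend-interchange h ((r , u) ∷ p) q =
    ≋-trans (++-cong (≋-sym (Extension.extend-pointwise-• _≟''_ (h u) r q))
                     (extend-interchange h p q))
            (≋-sym (Extension.extend-pointwise-++ _≟''_ (λ v → r • h u v)
                                                 (λ v → extend (λ u → h u v) p) q))

sumTo : {K : Set} → ℕ → (ℕ → Lin K) → Lin K
sumTo zero    f = f 0
sumTo (suc m) f = f 0 ++ sumTo m (λ k → f (suc k))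

sumTo-• : {K : Set} (m : ℕ) (r : ℚ) (f : ℕ → Lin K) → r • sumTo m f ≡ sumTo m (λ k → r • f k)
sumTo-• zero    r f = refl
sumTo-• (suc m) r f = trans (•-++ r (f 0) _) (cong (r • f 0 ++_) (sumTo-• m r (λ k → f (suc k))))

module Sums {K : Set} (_≟_ : DecidableEquality K) where
  open Coefficients _≟_

  sumTo-cong : ∀ m {f g : ℕ → Lin K} → (∀ k → f k ≋ g k) → sumTo m f ≋ sumTo m g
  sumTo-cong zero    e = e 0
  sumTo-cong (suc m) e = ++-cong (e 0) (sumTo-cong m (λ k → e (suc k)))

  sumTo-++ : ∀ m (f g : ℕ → Lin K) → sumTo m (λ k → f k ++ g k) ≋ sumTo m f ++ sumTo m g
  sumTo-++ zero    f g = ≋-refl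
  sumTo-++ (suc m) f g =
    ≋-trans (++-congˡ (f 0 ++ g 0) (sumTo-++ m (λ k → f (suc k)) (λ k → g (suc k))))
            (interchange (f 0) (g 0) _ _)

  sumTo-null : ∀ m (f : ℕ → Lin K) → (∀ k → f k ≋ []) → sumTo m f ≋ []
  sumTo-null zero    f e = e 0
  sumTo-null (suc m) f e = ++-cong (e 0) (sumTo-null m (λ k → f (suc k)) (λ k → e (suc k)))

  sumTo-last : ∀ m (f : ℕ → Lin K) → (∀ k → k ℕ.< m → f k ≋ []) → sumTo m f ≋ f m
  sumTo-last zero    f e = ≋-refl
  sumTo-last (suc m) f e =
    ≋-trans (++-zeroˡ (e 0 (s≤s z≤n))) (sumTo-last m (λ k → f (suc k)) (λ k k<m → e (suc k) (s≤s k<m)))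

  sumTo-swap : ∀ m n (f : ℕ → ℕ → Lin K) →
               sumTo m (λ k → sumTo n (f k)) ≋ sumTo n (λ l → sumTo m (λ k → f k l))
  sumTo-swap zero    n f = ≋-refl
  sumTo-swap (suc m) n f =
    ≋-trans (++-congˡ (sumTo n (f 0)) (sumTo-swap m n (λ k → f (suc k))))
            (≋-sym (sumTo-++ n (f 0) (λ l → sumTo m (λ k → f (suc k) l))))

  sumTo-triangle : ∀ m (f : ℕ → ℕ → Lin K) →
    sumTo m (λ k → sumTo (m ∸ k) (f k)) ≋ sumTo m (λ j → sumTo (m ∸ j) (λ k → f k j))
  sumTo-triangle zero          f = ≋-refl
  sumTo-triangle (suc zero)    f = ≋-trans (++-assoc (f 0 0) (f 0 1) (f 1 0))
    (≋-trans (++-congˡ (f 0 0) (++-comm (f 0 1) (f 1 0))) (≋-sym (++-assoc (f 0 0) (f 1 0) (f 0 1))))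
  sumTo-triangle (suc (suc m)) f = begin
    (f 0 0 ++ row₀) ++ sumTo (suc m) (λ k → sumTo (suc m ∸ k) (f (suc k)))
      ≈⟨ ++-congˡ (f 0 0 ++ row₀) (sumTo-triangle (suc m) (λ k → f (suc k))) ⟩
    (f 0 0 ++ row₀) ++ (column₀ ++ sumTo m (λ j → sumTo (m ∸ j) (λ k → f (suc k) (suc j))))
      ≈⟨ ++-congˡ (f 0 0 ++ row₀) (++-congˡ column₀ (≋-sym (sumTo-triangle m (λ k j → f (suc k) (suc j))))) ⟩
    (f 0 0 ++ row₀) ++ (column₀ ++ sumTo m (λ k → sumTo (m ∸ k) (λ j → f (suc k) (suc j))))
      ≈⟨ interchange (f 0 0) row₀ column₀ _ ⟩
    (f 0 0 ++ column₀) ++ sumTo (suc m) (λ k → sumTo (suc m ∸ k) (λ j → f k (suc j)))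
      ≈⟨ ++-congˡ (f 0 0 ++ column₀) (sumTo-triangle (suc m) (λ k j → f k (suc j))) ⟩
    (f 0 0 ++ column₀) ++ sumTo (suc m) (λ j → sumTo (suc m ∸ j) (λ k → f k (suc j)))
      ∎
    where
    open ≋-Reasoning
    row₀ column₀ : Lin K
    row₀    = sumTo (suc m) (λ j → f 0 (suc j))
    column₀ = sumTo (suc m) (λ k → f (suc k) 0)

module Blocks where

  _≟Z_ : DecidableEquality ZWord
  _≟Z_ = ListP.≡-dec ℕ._≟_

  open Coefficients _≟Z_
  open Extension {ZWord} {ZWord} _≟Z_
  open Respect {ZWord} {ZWord} _≟Z_ _≟Z_
  open Composition {ZWord} {ZWord} {ZWord} _≟Z_
  open Sums _≟Z_

  -- With the index j encoding z_{j+1}, the index of z_{k+l} is  k ⊙ l.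
  infixl 6 _⊙_
  _⊙_ : ℕ → ℕ → ℕ
  j ⊙ k = suc (j + k)

  ⊙-comm : ∀ j k → j ⊙ k ≡ k ⊙ j
  ⊙-comm j k = cong suc (ℕP.+-comm j k)

  ⊙-assoc : ∀ i j k → i ⊙ j ⊙ k ≡ i ⊙ (j ⊙ k)
  ⊙-assoc i j k = cong suc (trans (ℕP.+-assoc (suc i) j k) (sym (ℕP.+-suc i (j + k))))

  consZ-++ : ∀ j p q → consZ j (p ++ q) ≡ consZ j p ++ consZ j q
  consZ-++ j p q = ListP.map-++ _ p q

  consZ-• : ∀ j r p → consZ j (r • p) ≡ r • consZ j p
  consZ-• j r []            = refl
  consZ-• j r ((s , u) ∷ p) = cong ((r ℚ.* s , j ∷ u) ∷_) (consZ-• j r p)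

  consZ-cong : ∀ j {p q} → p ≋ q → consZ j p ≋ consZ j q
  consZ-cong j {p} {q} e = ≋-trans (as-extend p) (≋-trans (extend-resp (λ u → single (j ∷ u)) e)
                                                            (≋-sym (as-extend q)))
    where
    as-extend : ∀ p → consZ j p ≋ extend (λ u → single (j ∷ u)) p
    as-extend []            = ≋-refl
    as-extend ((r , u) ∷ p) = ∷-cong (j ∷ u) (sym (ℚP.*-identityʳ r)) (as-extend p)

  extend-consZ : ∀ {K} (f : ZWord → Lin K) j p → extend f (consZ j p) ≡ extend (λ u → f (j ∷ u)) p
  extend-consZ f j []            = refl
  extend-consZ f j ((r , u) ∷ p) = cong (r • f (j ∷ u) ++_) (extend-consZ f j p)

  extend-pointwise-consZ : ∀ (f : ZWord → ZPoly) j p →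
                           extend (λ u → consZ j (f u)) p ≡ consZ j (extend f p)
  extend-pointwise-consZ f j []            = refl
  extend-pointwise-consZ f j ((r , u) ∷ p) =
    trans (cong₂ _++_ (sym (consZ-• j r (f u))) (extend-pointwise-consZ f j p))
          (sym (consZ-++ j (r • f u) (extend f p)))

  extend-three-heads : ∀ (f g h : ZWord → ZPoly) a b c p →
    extend (λ u → consZ a (f u) ++ (consZ b (g u) ++ consZ c (h u))) p
      ≋ consZ a (extend f p) ++ (consZ b (extend g p) ++ consZ c (extend h p))
  extend-three-heads f g h a b c p = begin
    extend (λ u → consZ a (f u) ++ (consZ b (g u) ++ consZ c (h u))) p
      ≈⟨ extend-pointwise-++ (λ u → consZ a (f u)) (λ u → consZ b (g u) ++ consZ c (h u)) p ⟩
    extend (λ u → consZ a (f u)) p ++ extend (λ u → consZ b (g u) ++ consZ c (h u)) p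
      ≈⟨ ++-congˡ _ (extend-pointwise-++ (λ u → consZ b (g u)) (λ u → consZ c (h u)) p) ⟩
    extend (λ u → consZ a (f u)) p ++ (extend (λ u → consZ b (g u)) p ++ extend (λ u → consZ c (h u)) p)
      ≡⟨ cong₂ (λ s t → s ++ t) (extend-pointwise-consZ f a p)
               (cong₂ _++_ (extend-pointwise-consZ g b p) (extend-pointwise-consZ h c p)) ⟩
    consZ a (extend f p) ++ (consZ b (extend g p) ++ consZ c (extend h p)) ∎
    where open ≋-Reasoning

  infixl 7 _⋆ʷ_ _⋆_
  _⋆ʷ_ : ZWord → ZPoly → ZPoly
  u ⋆ʷ q = extend (harmZ u) q

  _⋆_ : ZPoly → ZPoly → ZPoly
  p ⋆ q = extend (λ u → u ⋆ʷ q) p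

  cons⋆ʷconsZ : ∀ e ρ j Q → (e ∷ ρ) ⋆ʷ consZ j Q ≋
    consZ e (ρ ⋆ʷ consZ j Q) ++ (consZ j ((e ∷ ρ) ⋆ʷ Q) ++ consZ (e ⊙ j) (ρ ⋆ʷ Q))
  cons⋆ʷconsZ e ρ j Q
    rewrite extend-consZ (harmZ (e ∷ ρ)) j Q | extend-consZ (harmZ ρ) j Q =
    extend-three-heads (λ v → harmZ ρ (j ∷ v)) (harmZ (e ∷ ρ)) (harmZ ρ) e j (e ⊙ j) Q

  consZ⋆cons : ∀ a P c w →
    extend (λ t → harmZ t (c ∷ w)) (consZ a P) ≋
    consZ a (extend (λ t → harmZ t (c ∷ w)) P) ++
    (consZ c (extend (λ t → harmZ (a ∷ t) w) P) ++ consZ (a ⊙ c) (extend (λ t → harmZ t w) P))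
  consZ⋆cons a P c w rewrite extend-consZ (λ t → harmZ t (c ∷ w)) a P =
    extend-three-heads (λ t → harmZ t (c ∷ w)) (λ t → harmZ (a ∷ t) w) (λ t → harmZ t w) a c (a ⊙ c) P

  harmZ-identityʳ : ∀ u → harmZ u [] ≡ single u
  harmZ-identityʳ []      = refl
  harmZ-identityʳ (_ ∷ _) = refl

  harmZ-comm : ∀ u v → harmZ u v ≋ harmZ v u
  harmZ-comm []      v       = ≡⇒≋ (sym (harmZ-identityʳ v))
  harmZ-comm (a ∷ u) []      = ≋-refl
  harmZ-comm (a ∷ u) (b ∷ v) = begin
    consZ a (harmZ u (b ∷ v)) ++ (consZ b (harmZ (a ∷ u) v) ++ consZ (a ⊙ b) (harmZ u v))
      ≈⟨ swap-front (consZ a (harmZ u (b ∷ v))) (consZ b (harmZ (a ∷ u) v)) _ ⟩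
    consZ b (harmZ (a ∷ u) v) ++ (consZ a (harmZ u (b ∷ v)) ++ consZ (a ⊙ b) (harmZ u v))
      ≈⟨ ++-cong (consZ-cong b (harmZ-comm (a ∷ u) v))
                 (++-cong (consZ-cong a (harmZ-comm u (b ∷ v)))
                          (≋-trans (≡⇒≋ (cong (λ i → consZ i (harmZ u v)) (⊙-comm a b)))
                                   (consZ-cong (b ⊙ a) (harmZ-comm u v)))) ⟩
    consZ b (harmZ v (a ∷ u)) ++ (consZ a (harmZ (b ∷ v) u) ++ consZ (b ⊙ a) (harmZ v u)) ∎
    where open ≋-Reasoning

  leftBracket rightBracket : ZWord → ZWord → ZWord → ZPoly
  leftBracket  u v w = extend (λ t → harmZ t w) (harmZ u v)
  rightBracket u v w = extend (harmZ u) (harmZ v w)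

  -- Both bracketings of  z_a u * z_b v * z_c w  unfold to seven terms, classified by
  -- which of the leading letters z_a, z_b, z_c merge into the new leading letter.
  expansion : (ZWord → ZWord → ZWord → ZPoly) → ℕ → ZWord → ℕ → ZWord → ℕ → ZWord → ZPoly
  expansion B a u b v c w =
    consZ c (B (a ∷ u) (b ∷ v) w) ++ (consZ a (B u (b ∷ v) (c ∷ w)) ++
    (consZ b (B (a ∷ u) v (c ∷ w)) ++ (consZ (a ⊙ b) (B u v (c ∷ w)) ++
    (consZ (a ⊙ c) (B u (b ∷ v) w) ++ (consZ (b ⊙ c) (B (a ∷ u) v w) ++
     consZ (a ⊙ b ⊙ c) (B u v w))))))

  leftBracket-expansion : ∀ a u b v c w →
    leftBracket (a ∷ u) (b ∷ v) (c ∷ w) ≋ expansion leftBracket a u b v c w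
  leftBracket-expansion a u b v c w = begin
    extend F (consZ a X₁ ++ (consZ b X₂ ++ consZ (a ⊙ b) X₃))
      ≡⟨ extend-++₃ F (consZ a X₁) (consZ b X₂) (consZ (a ⊙ b) X₃) ⟩
    extend F (consZ a X₁) ++ (extend F (consZ b X₂) ++ extend F (consZ (a ⊙ b) X₃))
      ≈⟨ ++-cong (consZ⋆cons a X₁ c w) (++-cong (consZ⋆cons b X₂ c w) (consZ⋆cons (a ⊙ b) X₃ c w)) ⟩
    (consZ a (extend F X₁) ++ (consZ c E₁ ++ consZ (a ⊙ c) (extend G X₁))) ++
    ((consZ b (extend F X₂) ++ (consZ c E₂ ++ consZ (b ⊙ c) (extend G X₂))) ++
     (consZ (a ⊙ b) (extend F X₃) ++ (consZ c E₃ ++ consZ (a ⊙ b ⊙ c) (extend G X₃))))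
      ≈⟨ regroup (consZ a (extend F X₁)) (consZ c E₁) (consZ (a ⊙ c) (extend G X₁))
                 (consZ b (extend F X₂)) (consZ c E₂) (consZ (b ⊙ c) (extend G X₂))
                 (consZ (a ⊙ b) (extend F X₃)) (consZ c E₃) (consZ (a ⊙ b ⊙ c) (extend G X₃)) ⟩
    (consZ c E₁ ++ (consZ c E₂ ++ consZ c E₃)) ++
    (consZ a (extend F X₁) ++ (consZ b (extend F X₂) ++ (consZ (a ⊙ b) (extend F X₃) ++
    (consZ (a ⊙ c) (extend G X₁) ++ (consZ (b ⊙ c) (extend G X₂) ++ consZ (a ⊙ b ⊙ c) (extend G X₃))))))
      ≈⟨ ++-congʳ _ (≡⇒≋ merge-c) ⟩
    expansion leftBracket a u b v c w ∎
    where
    open ≋-Reasoning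
    F G : ZWord → ZPoly
    F t = harmZ t (c ∷ w)
    G t = harmZ t w
    X₁ X₂ X₃ E₁ E₂ E₃ : ZPoly
    X₁ = harmZ u (b ∷ v)
    X₂ = harmZ (a ∷ u) v
    X₃ = harmZ u v
    E₁ = extend (λ t → harmZ (a ∷ t) w) X₁
    E₂ = extend (λ t → harmZ (b ∷ t) w) X₂
    E₃ = extend (λ t → harmZ (a ⊙ b ∷ t) w) X₃

    merge-c : consZ c E₁ ++ (consZ c E₂ ++ consZ c E₃) ≡ consZ c (leftBracket (a ∷ u) (b ∷ v) w)
    merge-c = sym (
      trans (cong (consZ c) (extend-++₃ G (consZ a X₁) (consZ b X₂) (consZ (a ⊙ b) X₃)))
      (trans (cong (consZ c) (cong₂ _++_ (extend-consZ G a X₁)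
                                         (cong₂ _++_ (extend-consZ G b X₂) (extend-consZ G (a ⊙ b) X₃))))
             (trans (consZ-++ c E₁ (E₂ ++ E₃)) (cong (consZ c E₁ ++_) (consZ-++ c E₂ E₃)))))

    regroup : ∀ a₁ a₂ a₃ b₁ b₂ b₃ c₁ c₂ c₃ →
      (a₁ ++ (a₂ ++ a₃)) ++ ((b₁ ++ (b₂ ++ b₃)) ++ (c₁ ++ (c₂ ++ c₃))) ≋
      (a₂ ++ (b₂ ++ c₂)) ++ (a₁ ++ (b₁ ++ (c₁ ++ (a₃ ++ (b₃ ++ c₃)))))
    regroup = solve 9 (λ a₁ a₂ a₃ b₁ b₂ b₃ c₁ c₂ c₃ →
      (a₁ ⊞ (a₂ ⊞ a₃)) ⊞ ((b₁ ⊞ (b₂ ⊞ b₃)) ⊞ (c₁ ⊞ (c₂ ⊞ c₃))) ⊜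
      (a₂ ⊞ (b₂ ⊞ c₂)) ⊞ (a₁ ⊞ (b₁ ⊞ (c₁ ⊞ (a₃ ⊞ (b₃ ⊞ c₃)))))) ≋-refl

  rightBracket-expansion : ∀ a u b v c w →
    rightBracket (a ∷ u) (b ∷ v) (c ∷ w) ≋ expansion rightBracket a u b v c w
  rightBracket-expansion a u b v c w = begin
    extend H (consZ b Y₁ ++ (consZ c Y₂ ++ consZ (b ⊙ c) Y₃))
      ≡⟨ extend-++₃ H (consZ b Y₁) (consZ c Y₂) (consZ (b ⊙ c) Y₃) ⟩
    extend H (consZ b Y₁) ++ (extend H (consZ c Y₂) ++ extend H (consZ (b ⊙ c) Y₃))
      ≈⟨ ++-cong (cons⋆ʷconsZ a u b Y₁) (++-cong (cons⋆ʷconsZ a u c Y₂) (cons⋆ʷconsZ a u (b ⊙ c) Y₃)) ⟩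
    (consZ a P₁ ++ (consZ b (extend H Y₁) ++ consZ (a ⊙ b) (extend (harmZ u) Y₁))) ++
    ((consZ a P₂ ++ (consZ c (extend H Y₂) ++ consZ (a ⊙ c) (extend (harmZ u) Y₂))) ++
     (consZ a P₃ ++ (consZ (b ⊙ c) (extend H Y₃) ++ consZ (a ⊙ (b ⊙ c)) (extend (harmZ u) Y₃))))
      ≈⟨ regroup (consZ a P₁) (consZ b (extend H Y₁)) (consZ (a ⊙ b) (extend (harmZ u) Y₁))
                 (consZ a P₂) (consZ c (extend H Y₂)) (consZ (a ⊙ c) (extend (harmZ u) Y₂))
                 (consZ a P₃) (consZ (b ⊙ c) (extend H Y₃)) (consZ (a ⊙ (b ⊙ c)) (extend (harmZ u) Y₃)) ⟩
    consZ c (extend H Y₂) ++ ((consZ a P₁ ++ (consZ a P₂ ++ consZ a P₃)) ++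
    (consZ b (extend H Y₁) ++ (consZ (a ⊙ b) (extend (harmZ u) Y₁) ++
    (consZ (a ⊙ c) (extend (harmZ u) Y₂) ++ (consZ (b ⊙ c) (extend H Y₃) ++
     consZ (a ⊙ (b ⊙ c)) (extend (harmZ u) Y₃))))))
      ≡⟨ cong₂ (λ s i → consZ c (extend H Y₂) ++ (s ++
                 (consZ b (extend H Y₁) ++ (consZ (a ⊙ b) (extend (harmZ u) Y₁) ++
                 (consZ (a ⊙ c) (extend (harmZ u) Y₂) ++ (consZ (b ⊙ c) (extend H Y₃) ++
                  consZ i (extend (harmZ u) Y₃)))))))
               merge-a (sym (⊙-assoc a b c)) ⟩
    expansion rightBracket a u b v c w ∎
    where
    open ≋-Reasoning
    H : ZWord → ZPoly
    H = harmZ (a ∷ u)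
    Y₁ Y₂ Y₃ P₁ P₂ P₃ : ZPoly
    Y₁ = harmZ v (c ∷ w)
    Y₂ = harmZ (b ∷ v) w
    Y₃ = harmZ v w
    P₁ = extend (harmZ u) (consZ b Y₁)
    P₂ = extend (harmZ u) (consZ c Y₂)
    P₃ = extend (harmZ u) (consZ (b ⊙ c) Y₃)

    merge-a : consZ a P₁ ++ (consZ a P₂ ++ consZ a P₃) ≡ consZ a (rightBracket u (b ∷ v) (c ∷ w))
    merge-a = sym (trans (cong (consZ a) (extend-++₃ (harmZ u) (consZ b Y₁) (consZ c Y₂) (consZ (b ⊙ c) Y₃)))
                         (trans (consZ-++ a P₁ (P₂ ++ P₃)) (cong (consZ a P₁ ++_) (consZ-++ a P₂ P₃))))

    regroup : ∀ a₁ a₂ a₃ b₁ b₂ b₃ c₁ c₂ c₃ →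
      (a₁ ++ (a₂ ++ a₃)) ++ ((b₁ ++ (b₂ ++ b₃)) ++ (c₁ ++ (c₂ ++ c₃))) ≋
      b₂ ++ ((a₁ ++ (b₁ ++ c₁)) ++ (a₂ ++ (a₃ ++ (b₃ ++ (c₂ ++ c₃)))))
    regroup = solve 9 (λ a₁ a₂ a₃ b₁ b₂ b₃ c₁ c₂ c₃ →
      (a₁ ⊞ (a₂ ⊞ a₃)) ⊞ ((b₁ ⊞ (b₂ ⊞ b₃)) ⊞ (c₁ ⊞ (c₂ ⊞ c₃))) ⊜
      b₂ ⊞ ((a₁ ⊞ (b₁ ⊞ c₁)) ⊞ (a₂ ⊞ (a₃ ⊞ (b₃ ⊞ (c₂ ⊞ c₃)))))) ≋-refl

  harmZ-assoc : ∀ u v w → leftBracket u v w ≋ rightBracket u v w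
  harmZ-assoc [] v w =
    ≋-trans (extend-single (λ t → harmZ t w) v) (≋-sym (extend-single-unit (harmZ v w)))
  harmZ-assoc (a ∷ u) [] w =
    ≋-trans (extend-single (λ t → harmZ t w) (a ∷ u)) (≋-sym (extend-single (harmZ (a ∷ u)) w))
  harmZ-assoc (a ∷ u) (b ∷ v) [] =
    ≋-trans (extend-cong (harmZ (a ∷ u) (b ∷ v)) (λ t → ≡⇒≋ (harmZ-identityʳ t)))
    (≋-trans (extend-single-unit (harmZ (a ∷ u) (b ∷ v))) (≋-sym (extend-single (harmZ (a ∷ u)) (b ∷ v))))
  harmZ-assoc (a ∷ u) (b ∷ v) (c ∷ w) =
    ≋-trans (leftBracket-expansion a u b v c w)
    (≋-trans (++-cong (consZ-cong c (harmZ-assoc (a ∷ u) (b ∷ v) w))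
             (++-cong (consZ-cong a (harmZ-assoc u (b ∷ v) (c ∷ w)))
             (++-cong (consZ-cong b (harmZ-assoc (a ∷ u) v (c ∷ w)))
             (++-cong (consZ-cong (a ⊙ b) (harmZ-assoc u v (c ∷ w)))
             (++-cong (consZ-cong (a ⊙ c) (harmZ-assoc u (b ∷ v) w))
             (++-cong (consZ-cong (b ⊙ c) (harmZ-assoc (a ∷ u) v w))
                      (consZ-cong (a ⊙ b ⊙ c) (harmZ-assoc u v w))))))))
    (≋-sym (rightBracket-expansion a u b v c w)))

  ⋆ʷ-cong : ∀ u {q q'} → q ≋ q' → u ⋆ʷ q ≋ u ⋆ʷ q'
  ⋆ʷ-cong u = extend-resp (harmZ u)

  ⋆-cong : ∀ {p p' q q'} → p ≋ p' → q ≋ q' → p ⋆ q ≋ p' ⋆ q'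
  ⋆-cong {p} {p'} {q} {q'} p≋p' q≋q' =
    ≋-trans (extend-resp (λ u → u ⋆ʷ q) p≋p') (extend-cong p' (λ u → ⋆ʷ-cong u q≋q'))

  ⋆-congˡ : ∀ p {q q'} → q ≋ q' → p ⋆ q ≋ p ⋆ q'
  ⋆-congˡ p = ⋆-cong (≋-refl {p})

  ⋆-congʳ : ∀ q {p p'} → p ≋ p' → p ⋆ q ≋ p' ⋆ q
  ⋆-congʳ q e = ⋆-cong e (≋-refl {q})

  ⋆-comm : ∀ p q → p ⋆ q ≋ q ⋆ p
  ⋆-comm p q = ≋-trans (extend-interchange harmZ p q)
    (extend-cong q (λ v → extend-cong p (λ u → harmZ-comm u v)))

  ⋆-assoc : ∀ p q r → (p ⋆ q) ⋆ r ≋ p ⋆ (q ⋆ r)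
  ⋆-assoc p q r = begin
    extend (λ t → t ⋆ʷ r) (extend (λ u → u ⋆ʷ q) p)
      ≈⟨ extend-extend (λ u → u ⋆ʷ q) (λ t → t ⋆ʷ r) p ⟩
    extend (λ u → extend (λ t → t ⋆ʷ r) (u ⋆ʷ q)) p
      ≈⟨ extend-cong p (λ u → extend-extend (harmZ u) (λ t → t ⋆ʷ r) q) ⟩
    extend (λ u → extend (λ v → extend (λ t → t ⋆ʷ r) (harmZ u v)) q) p
      ≈⟨ extend-cong p (λ u → extend-cong q (λ v → words u v)) ⟩
    extend (λ u → extend (λ v → u ⋆ʷ (v ⋆ʷ r)) q) p
      ≈⟨ extend-cong p (λ u → ≋-sym (extend-extend (λ v → v ⋆ʷ r) (harmZ u) q)) ⟩
    extend (λ u → u ⋆ʷ (q ⋆ r)) p ∎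
    where
    open ≋-Reasoning
    words : ∀ u v → extend (λ t → t ⋆ʷ r) (harmZ u v) ≋ u ⋆ʷ (v ⋆ʷ r)
    words u v = ≋-trans (extend-interchange (λ t s → harmZ t s) (harmZ u v) r)
      (≋-trans (extend-cong r (harmZ-assoc u v)) (≋-sym (extend-extend (harmZ v) (harmZ u) r)))

  ⋆ʷ-identity : ∀ u → u ⋆ʷ single [] ≋ single u
  ⋆ʷ-identity u = ≋-trans (extend-single (harmZ u) []) (≡⇒≋ (harmZ-identityʳ u))

  []⋆ʷ : ∀ q → [] ⋆ʷ q ≋ q
  []⋆ʷ = extend-single-unit

  single⋆ : ∀ u q → single u ⋆ q ≋ u ⋆ʷ q
  single⋆ u q = extend-single (λ u → u ⋆ʷ q) u

  ⋆-identityʳ : ∀ p → p ⋆ single [] ≋ p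
  ⋆-identityʳ p = ≋-trans (extend-cong p ⋆ʷ-identity) (extend-single-unit p)

  ⋆-zeroʳ : ∀ p → p ⋆ [] ≋ []
  ⋆-zeroʳ = extend-pointwise-zero

  ⋆ʷ-++ : ∀ u q q' → u ⋆ʷ (q ++ q') ≡ u ⋆ʷ q ++ u ⋆ʷ q'
  ⋆ʷ-++ u = extend-++ (harmZ u)

  ⋆-++ˡ : ∀ p p' q → (p ++ p') ⋆ q ≡ p ⋆ q ++ p' ⋆ q
  ⋆-++ˡ p p' q = extend-++ (λ u → u ⋆ʷ q) p p'

  ⋆-++ʳ : ∀ p q q' → p ⋆ (q ++ q') ≋ p ⋆ q ++ p ⋆ q'
  ⋆-++ʳ p q q' = ≋-trans (extend-cong p (λ u → ≡⇒≋ (⋆ʷ-++ u q q')))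
                         (extend-pointwise-++ (λ u → u ⋆ʷ q) (λ u → u ⋆ʷ q') p)

  ⋆-•ˡ : ∀ r p q → (r • p) ⋆ q ≋ r • (p ⋆ q)
  ⋆-•ˡ r p q = extend-• (λ u → u ⋆ʷ q) r p

  ⋆-•ʳ : ∀ r p q → p ⋆ (r • q) ≋ r • (p ⋆ q)
  ⋆-•ʳ r p q = ≋-trans (extend-cong p (λ u → extend-• (harmZ u) r q))
                       (extend-pointwise-• (λ u → u ⋆ʷ q) r p)

  ⋆-sumToˡ : ∀ m (f : ℕ → ZPoly) q → sumTo m f ⋆ q ≋ sumTo m (λ k → f k ⋆ q)
  ⋆-sumToˡ zero    f q = ≋-refl
  ⋆-sumToˡ (suc m) f q = ≋-trans (≡⇒≋ (⋆-++ˡ (f 0) (sumTo m (λ k → f (suc k))) q))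
                                 (++-congˡ (f 0 ⋆ q) (⋆-sumToˡ m (λ k → f (suc k)) q))

  ⋆-sumToʳ : ∀ p m (f : ℕ → ZPoly) → p ⋆ sumTo m f ≋ sumTo m (λ k → p ⋆ f k)
  ⋆-sumToʳ p zero    f = ≋-refl
  ⋆-sumToʳ p (suc m) f = ≋-trans (⋆-++ʳ p (f 0) (sumTo m (λ k → f (suc k))))
                                 (++-congˡ (p ⋆ f 0) (⋆-sumToʳ p m (λ k → f (suc k))))

  -- The map d on words of ℌ¹, in the block encoding:  dZ-from j v = d(z_{j+1} v).
  -- Since γ(z_k) = x^{k-1}(x + y), d either keeps z_{j+1} as a letter or merges it
  -- into the next block.
  dZ-from : ℕ → ZWord → ZPoly
  dZ-from j []      = single (j ∷ [])
  dZ-from j (k ∷ v) = consZ j (dZ-from k v) ++ dZ-from (j ⊙ k) v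

  dZ : ZWord → ZPoly
  dZ []      = single []
  dZ (j ∷ v) = dZ-from j v

  -- dZ-after ρ j v is  d(z_{j+1} v)  with ρ ⋆ inserted behind the leading letter of
  -- every term:  Σᵢ z_{j ⊙ v₁ ⊙ ⋯ ⊙ vᵢ} (ρ ⋆ d(v_{>i})).
  dZ-after : ZWord → ℕ → ZWord → ZPoly
  dZ-after ρ j []      = consZ j (ρ ⋆ʷ single [])
  dZ-after ρ j (k ∷ v) = consZ j (ρ ⋆ʷ dZ-from k v) ++ dZ-after ρ (j ⊙ k) v

  dZ-afterʷ : ZWord → ZWord → ZPoly
  dZ-afterʷ ρ []      = []
  dZ-afterʷ ρ (j ∷ v) = dZ-after ρ j v

  dZ-after-[] : ∀ j v → dZ-after [] j v ≋ dZ-from j v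
  dZ-after-[] j []      = consZ-cong j ([]⋆ʷ (single []))
  dZ-after-[] j (k ∷ v) = ++-cong (consZ-cong j ([]⋆ʷ (dZ-from k v))) (dZ-after-[] (j ⊙ k) v)

  -- z_e ρ ⋆ d(z_j v) splits according to the leading letter of each term: it comes
  -- from z_j v alone, from z_e alone, or from a merger of both.
  cons⋆dZ-from : ∀ e ρ j v → (e ∷ ρ) ⋆ʷ dZ-from j v ≋
    dZ-after (e ∷ ρ) j v ++ (dZ-after ρ (e ⊙ j) v ++ consZ e (ρ ⋆ʷ dZ-from j v))
  cons⋆dZ-from e ρ j [] =
    ≋-trans (cons⋆ʷconsZ e ρ j (single []))
            (rotate (consZ e (ρ ⋆ʷ consZ j (single []))) (consZ j ((e ∷ ρ) ⋆ʷ single []))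
                    (consZ (e ⊙ j) (ρ ⋆ʷ single [])))
    where
    rotate : ∀ p q r → p ++ (q ++ r) ≋ q ++ (r ++ p)
    rotate = solve 3 (λ p q r → p ⊞ (q ⊞ r) ⊜ q ⊞ (r ⊞ p)) ≋-refl
  cons⋆dZ-from e ρ j (k ∷ v) = begin
    (e ∷ ρ) ⋆ʷ (consZ j (dZ-from k v) ++ dZ-from (j ⊙ k) v)
      ≡⟨ ⋆ʷ-++ (e ∷ ρ) (consZ j (dZ-from k v)) (dZ-from (j ⊙ k) v) ⟩
    (e ∷ ρ) ⋆ʷ consZ j (dZ-from k v) ++ (e ∷ ρ) ⋆ʷ dZ-from (j ⊙ k) v
      ≈⟨ ++-cong (cons⋆ʷconsZ e ρ j (dZ-from k v)) (cons⋆dZ-from e ρ (j ⊙ k) v) ⟩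
    (consZ e (ρ ⋆ʷ consZ j (dZ-from k v)) ++ (consZ j ((e ∷ ρ) ⋆ʷ dZ-from k v) ++
       consZ (e ⊙ j) (ρ ⋆ʷ dZ-from k v))) ++
    (dZ-after (e ∷ ρ) (j ⊙ k) v ++ (dZ-after ρ (e ⊙ (j ⊙ k)) v ++ consZ e (ρ ⋆ʷ dZ-from (j ⊙ k) v)))
      ≈⟨ regroup (consZ e (ρ ⋆ʷ consZ j (dZ-from k v))) (consZ j ((e ∷ ρ) ⋆ʷ dZ-from k v))
                 (consZ (e ⊙ j) (ρ ⋆ʷ dZ-from k v)) (dZ-after (e ∷ ρ) (j ⊙ k) v)
                 (dZ-after ρ (e ⊙ (j ⊙ k)) v) (consZ e (ρ ⋆ʷ dZ-from (j ⊙ k) v)) ⟩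
    (consZ j ((e ∷ ρ) ⋆ʷ dZ-from k v) ++ dZ-after (e ∷ ρ) (j ⊙ k) v) ++
    ((consZ (e ⊙ j) (ρ ⋆ʷ dZ-from k v) ++ dZ-after ρ (e ⊙ (j ⊙ k)) v) ++
     (consZ e (ρ ⋆ʷ consZ j (dZ-from k v)) ++ consZ e (ρ ⋆ʷ dZ-from (j ⊙ k) v)))
      ≡⟨ cong₂ (λ i s → (consZ j ((e ∷ ρ) ⋆ʷ dZ-from k v) ++ dZ-after (e ∷ ρ) (j ⊙ k) v) ++
                        ((consZ (e ⊙ j) (ρ ⋆ʷ dZ-from k v) ++ dZ-after ρ i v) ++ s))
               (sym (⊙-assoc e j k))
               (sym (trans (cong (consZ e) (⋆ʷ-++ ρ (consZ j (dZ-from k v)) (dZ-from (j ⊙ k) v)))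
                           (consZ-++ e (ρ ⋆ʷ consZ j (dZ-from k v)) (ρ ⋆ʷ dZ-from (j ⊙ k) v)))) ⟩
    dZ-after (e ∷ ρ) j (k ∷ v) ++ (dZ-after ρ (e ⊙ j) (k ∷ v) ++ consZ e (ρ ⋆ʷ dZ-from j (k ∷ v))) ∎
    where
    open ≋-Reasoning
    regroup : ∀ a₁ a₂ a₃ a₄ a₅ a₆ →
      (a₁ ++ (a₂ ++ a₃)) ++ (a₄ ++ (a₅ ++ a₆)) ≋ (a₂ ++ a₄) ++ ((a₃ ++ a₅) ++ (a₁ ++ a₆))
    regroup = solve 6 (λ a₁ a₂ a₃ a₄ a₅ a₆ →
      (a₁ ⊞ (a₂ ⊞ a₃)) ⊞ (a₄ ⊞ (a₅ ⊞ a₆)) ⊜ (a₂ ⊞ a₄) ⊞ ((a₃ ⊞ a₅) ⊞ (a₁ ⊞ a₆))) ≋-refl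

  cons⋆dZ : ∀ e ρ v → (e ∷ ρ) ⋆ʷ dZ v ≋ dZ-afterʷ (e ∷ ρ) v ++ dZ-afterʷ ρ (e ∷ v)
  cons⋆dZ e ρ []      = ≋-trans (⋆ʷ-identity (e ∷ ρ)) (consZ-cong e (≋-sym (⋆ʷ-identity ρ)))
  cons⋆dZ e ρ (j ∷ v) = ≋-trans (cons⋆dZ-from e ρ j v)
    (++-congˡ (dZ-after (e ∷ ρ) j v) (++-comm (dZ-after ρ (e ⊙ j) v) (consZ e (ρ ⋆ʷ dZ-from j v))))

  -- The alternating sum  Σₖ (-1)ᵏ (vₖ ⋯ v₁ ρ) ⋆ d(v_{k+1} ⋯ v_r), defined by peeling
  -- letters off v onto the (reversed) accumulator ρ.
  alternating : ZWord → ZWord → ZPoly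
  alternating ρ []      = ρ ⋆ʷ single []
  alternating ρ (e ∷ v) = ρ ⋆ʷ dZ (e ∷ v) ++ neg (alternating (e ∷ ρ) v)

  alternating-telescopes : ∀ h ρ v → alternating (h ∷ ρ) v ≋ dZ-afterʷ ρ (h ∷ v)
  alternating-telescopes h ρ []      = cons⋆dZ h ρ []
  alternating-telescopes h ρ (e ∷ v) = begin
    (h ∷ ρ) ⋆ʷ dZ (e ∷ v) ++ neg (alternating (e ∷ h ∷ ρ) v)
      ≈⟨ ++-cong (cons⋆dZ h ρ (e ∷ v)) (•-cong (ℚ.- 1ℚ) (alternating-telescopes e (h ∷ ρ) v)) ⟩
    (P ++ dZ-afterʷ ρ (h ∷ e ∷ v)) ++ neg P
      ≈⟨ solve 3 (λ p q r → (p ⊞ q) ⊞ r ⊜ (p ⊞ r) ⊞ q) ≋-refl P _ (neg P) ⟩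
    (P ++ neg P) ++ dZ-afterʷ ρ (h ∷ e ∷ v)
      ≈⟨ ++-zeroˡ (neg-cancel P) ⟩
    dZ-afterʷ ρ (h ∷ e ∷ v) ∎
    where
    open ≋-Reasoning
    P : ZPoly
    P = dZ-afterʷ (h ∷ ρ) (e ∷ v)

  alternating-vanishes : ∀ e v → alternating [] (e ∷ v) ≋ []
  alternating-vanishes e v = ≋-trans
    (++-cong ([]⋆ʷ (dZ (e ∷ v)))
             (•-cong (ℚ.- 1ℚ) (≋-trans (alternating-telescopes e [] v) (dZ-after-[] e v))))
    (neg-cancel (dZ (e ∷ v)))

  sgn-+ : ∀ m l → sgn (m + l) ≡ sgn m ℚ.* sgn l
  sgn-+ zero    l = sym (ℚP.*-identityˡ (sgn l))
  sgn-+ (suc m) l = trans (cong ℚ.-_ (sgn-+ m l)) (ℚP.neg-distribˡ-* (sgn m) (sgn l))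

  neg-sgn : ∀ k p → neg (sgn k • p) ≋ sgn (suc k) • p
  neg-sgn k p = ≋-trans (•-• (ℚ.- 1ℚ) (sgn k) p)
    (≡⇒≋ (cong (_• p) (trans (sym (ℚP.neg-distribˡ-* 1ℚ (sgn k))) (cong ℚ.-_ (ℚP.*-identityˡ (sgn k))))))

  replicate-snoc : ∀ k (i : ℕ) ρ → replicate k i ++ i ∷ ρ ≡ i ∷ (replicate k i ++ ρ)
  replicate-snoc zero    i ρ = refl
  replicate-snoc (suc k) i ρ = cong (i ∷_) (replicate-snoc k i ρ)

  neg-shift : ∀ m i ρ (D : ℕ → ZPoly) →
    neg (sumTo m (λ k → sgn k • ((replicate k i ++ i ∷ ρ) ⋆ʷ D k)))
      ≋ sumTo m (λ k → sgn (suc k) • ((replicate (suc k) i ++ ρ) ⋆ʷ D k))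
  neg-shift m i ρ D = ≋-trans (≡⇒≋ (sumTo-• m (ℚ.- 1ℚ) _)) (sumTo-cong m λ k →
    ≋-trans (neg-sgn k _) (≡⇒≋ (cong (λ w → sgn (suc k) • (w ⋆ʷ D k)) (replicate-snoc k i ρ))))

  alternating-block-letter : ∀ i b m ρ t → alternating ρ (replicate m i ++ b ∷ t) ≋
    sumTo m (λ k → sgn k • ((replicate k i ++ ρ) ⋆ʷ dZ (replicate (m ∸ k) i ++ b ∷ t)))
      ++ sgn (suc m) • alternating (b ∷ replicate m i ++ ρ) t
  alternating-block-letter i b zero    ρ t = ++-congʳ _ (≋-sym (1• (ρ ⋆ʷ dZ (b ∷ t))))
  alternating-block-letter i b (suc m) ρ t = begin
    ρ ⋆ʷ dZ (replicate (suc m) i ++ b ∷ t) ++ neg (alternating (i ∷ ρ) (replicate m i ++ b ∷ t))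
      ≈⟨ ++-cong (≋-sym (1• _)) (•-cong (ℚ.- 1ℚ) (alternating-block-letter i b m (i ∷ ρ) t)) ⟩
    1ℚ • (ρ ⋆ʷ dZ (replicate (suc m) i ++ b ∷ t)) ++ neg (front ++ sgn (suc m) • rest)
      ≡⟨ cong (1ℚ • (ρ ⋆ʷ dZ (replicate (suc m) i ++ b ∷ t)) ++_) (•-++ (ℚ.- 1ℚ) front _) ⟩
    1ℚ • (ρ ⋆ʷ dZ (replicate (suc m) i ++ b ∷ t)) ++ (neg front ++ neg (sgn (suc m) • rest))
      ≈⟨ ++-congˡ (1ℚ • (ρ ⋆ʷ dZ (replicate (suc m) i ++ b ∷ t))) (++-cong (neg-shift m i ρ (λ k → dZ (replicate (m ∸ k) i ++ b ∷ t)))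
                             (≋-trans (neg-sgn (suc m) rest)
                                      (≡⇒≋ (cong (λ w → sgn (suc (suc m)) • alternating (b ∷ w) t)
                                                 (replicate-snoc m i ρ))))) ⟩
    1ℚ • (ρ ⋆ʷ dZ (replicate (suc m) i ++ b ∷ t)) ++
      (sumTo m (λ k → sgn (suc k) • ((replicate (suc k) i ++ ρ) ⋆ʷ dZ (replicate (m ∸ k) i ++ b ∷ t)))
       ++ sgn (suc (suc m)) • alternating (b ∷ replicate (suc m) i ++ ρ) t)
      ≈⟨ ≋-sym (++-assoc (1ℚ • (ρ ⋆ʷ dZ (replicate (suc m) i ++ b ∷ t)))
                        (sumTo m (λ k → sgn (suc k) • ((replicate (suc k) i ++ ρ) ⋆ʷ
                                                         dZ (replicate (m ∸ k) i ++ b ∷ t))))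
                        (sgn (suc (suc m)) • alternating (b ∷ replicate (suc m) i ++ ρ) t)) ⟩
    sumTo (suc m) (λ k → sgn k • ((replicate k i ++ ρ) ⋆ʷ dZ (replicate (suc m ∸ k) i ++ b ∷ t)))
      ++ sgn (suc (suc m)) • alternating (b ∷ replicate (suc m) i ++ ρ) t ∎
    where
    open ≋-Reasoning
    front rest : ZPoly
    front = sumTo m (λ k → sgn k • ((replicate k i ++ i ∷ ρ) ⋆ʷ dZ (replicate (m ∸ k) i ++ b ∷ t)))
    rest = alternating (b ∷ replicate m i ++ i ∷ ρ) t

  alternating-block : ∀ i n ρ → alternating ρ (replicate n i) ≋
    sumTo n (λ l → sgn l • ((replicate l i ++ ρ) ⋆ʷ dZ (replicate (n ∸ l) i)))
  alternating-block i zero    ρ = ≋-sym (1• (ρ ⋆ʷ single []))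
  alternating-block i (suc n) ρ =
    ++-cong (≋-sym (1• (ρ ⋆ʷ dZ (replicate (suc n) i))))
            (≋-trans (•-cong (ℚ.- 1ℚ) (alternating-block i n (i ∷ ρ)))
                     (neg-shift n i ρ (λ l → dZ (replicate (n ∸ l) i))))

  module Convolution (c : ℕ) where

    power : ℕ → ZPoly → ZPoly
    power k X = sgn k • (replicate k c ⋆ʷ X)

    conv : (ℕ → ZPoly) → ℕ → ZPoly
    conv H m = sumTo m (λ k → power k (H (m ∸ k)))

    power-cong : ∀ k {X Y} → X ≋ Y → power k X ≋ power k Y
    power-cong k e = •-cong (sgn k) (⋆ʷ-cong (replicate k c) e)

    power-zero : ∀ X → power 0 X ≋ X
    power-zero X = ≋-trans (1• _) ([]⋆ʷ X)

    power-sumTo : ∀ k j (f : ℕ → ZPoly) → power k (sumTo j f) ≋ sumTo j (λ i → power k (f i))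
    power-sumTo k j f = ≋-trans (•-cong (sgn k) (≋-trans (≋-sym (single⋆ (replicate k c) (sumTo j f)))
                                          (≋-trans (⋆-sumToʳ (single (replicate k c)) j f)
                                                   (sumTo-cong j (λ i → single⋆ (replicate k c) (f i))))))
                                (≡⇒≋ (sumTo-• j (sgn k) _))

    -- conv is injective: its leading term  power 0  is the identity.
    conv-injective : ∀ {F R : ℕ → ZPoly} → (∀ m → conv F m ≋ conv R m) → ∀ m → F m ≋ R m
    conv-injective {F} {R} conv≋ m = bounded m m ℕP.≤-refl
      where
      bounded : ∀ M j → j ≤ M → F j ≋ R j
      bounded M zero _ = ≋-trans (≋-sym (power-zero (F 0))) (≋-trans (conv≋ 0) (power-zero (R 0)))
      bounded (suc M) (suc j) (s≤s j≤M) =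
        ≋-trans (≋-sym (power-zero (F (suc j))))
        (≋-trans (cancelʳ (power 0 (F (suc j))) (power 0 (R (suc j))) tailR
                   (≋-trans (++-congˡ (power 0 (F (suc j))) (≋-sym tails≋)) (conv≋ (suc j))))
                 (power-zero (R (suc j))))
        where
        tailR : ZPoly
        tailR = sumTo j (λ k → power (suc k) (R (j ∸ k)))
        tails≋ : sumTo j (λ k → power (suc k) (F (j ∸ k))) ≋ tailR
        tails≋ = sumTo-cong j (λ k → power-cong (suc k) (bounded M (j ∸ k) (ℕP.≤-trans (ℕP.m∸n≤m j k) j≤M)))

  commute-power : ∀ s r g w X A →
    s • (w ⋆ʷ (r • ((g ⋆ X) ⋆ A))) ≋ r • ((g ⋆ (s • (w ⋆ʷ X))) ⋆ A)
  commute-power s r g w X A = begin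
    s • (w ⋆ʷ (r • ((g ⋆ X) ⋆ A)))
      ≈⟨ •-cong s (≋-trans (≋-sym (single⋆ w (r • ((g ⋆ X) ⋆ A)))) (⋆-•ʳ r (single w) ((g ⋆ X) ⋆ A))) ⟩
    s • (r • (single w ⋆ ((g ⋆ X) ⋆ A)))
      ≈⟨ •-comm s r _ ⟩
    r • (s • (single w ⋆ ((g ⋆ X) ⋆ A)))
      ≈⟨ •-cong r (•-cong s (≋-sym (⋆-assoc (single w) (g ⋆ X) A))) ⟩
    r • (s • ((single w ⋆ (g ⋆ X)) ⋆ A))
      ≈⟨ •-cong r (•-cong s (⋆-congʳ A reorder)) ⟩
    r • (s • ((g ⋆ (single w ⋆ X)) ⋆ A))
      ≈⟨ •-cong r (≋-sym (⋆-•ˡ s (g ⋆ (single w ⋆ X)) A)) ⟩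
    r • ((s • (g ⋆ (single w ⋆ X))) ⋆ A)
      ≈⟨ •-cong r (⋆-congʳ A (≋-sym (⋆-•ʳ s g (single w ⋆ X)))) ⟩
    r • ((g ⋆ (s • (single w ⋆ X))) ⋆ A)
      ≈⟨ •-cong r (⋆-congʳ A (⋆-congˡ g (•-cong s (single⋆ w X)))) ⟩
    r • ((g ⋆ (s • (w ⋆ʷ X))) ⋆ A) ∎
    where
    open ≋-Reasoning
    reorder : single w ⋆ (g ⋆ X) ≋ g ⋆ (single w ⋆ X)
    reorder = ≋-trans (≋-sym (⋆-assoc (single w) g X))
              (≋-trans (⋆-congʳ X (⋆-comm (single w) g)) (⋆-assoc g (single w) X))

  ++[]⋆ʷ : ∀ w X → (w ++ []) ⋆ʷ X ≡ w ⋆ʷ X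
  ++[]⋆ʷ w X = cong (_⋆ʷ X) (ListP.++-identityʳ w)

  -- Proposition 2.4 in the block encoding: letters z_{a+1}, z_{b+1}, z_{c+1}, with n fixed.
  module Proposition (a b c n : ℕ) where
    open Convolution c

    middle : ℕ → ℕ → ZWord
    middle l k = replicate l a ++ b ∷ replicate k c

    dC dA : ℕ → ZPoly
    dC j = dZ (replicate j c)
    dA l = dZ (replicate l a)

    lhs : ℕ → ZPoly
    lhs m = dZ (replicate m c ++ b ∷ replicate n a)

    withC : ℕ → ZPoly → ZPoly
    withC k X = sumTo n (λ l → sgn (k + l) • ((single (middle l k) ⋆ X) ⋆ dA (n ∸ l)))

    rhs : ℕ → ZPoly
    rhs m = sumTo m (λ k → withC k (dC (m ∸ k)))

    -- The value of both convolutions.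
    boundary : ℕ → ZPoly
    boundary m = withC m (single [])

    withC-cong : ∀ k {X Y} → X ≋ Y → withC k X ≋ withC k Y
    withC-cong k e = sumTo-cong n (λ l → •-cong (sgn (k + l)) (⋆-congʳ (dA (n ∸ l)) (⋆-congˡ (single (middle l k)) e)))

    withC-linear : ∀ k j (Y : ℕ → ZPoly) → sumTo j (λ i → withC k (Y i)) ≋ withC k (sumTo j Y)
    withC-linear k j Y = ≋-trans (sumTo-swap j n _) (sumTo-cong n λ l →
      ≋-trans (≡⇒≋ (sym (sumTo-• j (sgn (k + l)) _)))
      (•-cong (sgn (k + l)) (≋-sym (≋-trans (⋆-congʳ (dA (n ∸ l)) (⋆-sumToʳ (single (middle l k)) j Y))
                                            (⋆-sumToˡ j _ (dA (n ∸ l)))))))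

    conv-lhs : ∀ m → conv lhs m ≋ boundary m
    conv-lhs m = difference-zero (conv lhs m) (boundary m) (begin
      conv lhs m ++ neg (boundary m)
        ≈⟨ ++-cong (sumTo-cong m (λ k → ≡⇒≋ (cong (sgn k •_) (sym (++[]⋆ʷ (replicate k c) (lhs (m ∸ k)))))))
                   neg-boundary ⟩
      sumTo m (λ k → sgn k • ((replicate k c ++ []) ⋆ʷ lhs (m ∸ k)))
        ++ sgn (suc m) • alternating (b ∷ replicate m c ++ []) (replicate n a)
        ≈⟨ ≋-sym (alternating-block-letter c b m [] (replicate n a)) ⟩
      alternating [] (replicate m c ++ b ∷ replicate n a)
        ≈⟨ vanishes m ⟩
      [] ∎)
      where
      open ≋-Reasoning
      vanishes : ∀ m → alternating [] (replicate m c ++ b ∷ replicate n a) ≋ []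
      vanishes zero    = alternating-vanishes b (replicate n a)
      vanishes (suc m) = alternating-vanishes c (replicate m c ++ b ∷ replicate n a)

      neg-boundary : neg (boundary m) ≋ sgn (suc m) • alternating (b ∷ replicate m c ++ []) (replicate n a)
      neg-boundary = begin
        neg (boundary m)
          ≡⟨ sumTo-• n (ℚ.- 1ℚ) _ ⟩
        sumTo n (λ l → neg (sgn (m + l) • ((single (middle l m) ⋆ single []) ⋆ dA (n ∸ l))))
          ≈⟨ sumTo-cong n (λ l → ≋-trans (neg-sgn (m + l) (term l)) (≋-trans
               (≡⇒≋ (cong (_• term l) (sgn-+ (suc m) l)))
               (≋-trans (≋-sym (•-• (sgn (suc m)) (sgn l) (term l)))
               (•-cong (sgn (suc m)) (•-cong (sgn l) (term-as-word l)))))) ⟩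
        sumTo n (λ l → sgn (suc m) • (sgn l • ((replicate l a ++ b ∷ replicate m c ++ []) ⋆ʷ dA (n ∸ l))))
          ≡⟨ sym (sumTo-• n (sgn (suc m)) _) ⟩
        sgn (suc m) • sumTo n (λ l → sgn l • ((replicate l a ++ b ∷ replicate m c ++ []) ⋆ʷ dA (n ∸ l)))
          ≈⟨ •-cong (sgn (suc m)) (≋-sym (alternating-block a n (b ∷ replicate m c ++ []))) ⟩
        sgn (suc m) • alternating (b ∷ replicate m c ++ []) (replicate n a) ∎
        where
        term : ℕ → ZPoly
        term l = (single (middle l m) ⋆ single []) ⋆ dA (n ∸ l)

        term-as-word : ∀ l → term l ≋ (replicate l a ++ b ∷ replicate m c ++ []) ⋆ʷ dA (n ∸ l)
        term-as-word l = ≋-trans (⋆-congʳ (dA (n ∸ l)) (⋆-identityʳ (single (middle l m))))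
          (≋-trans (single⋆ (middle l m) (dA (n ∸ l)))
                   (≡⇒≋ (cong (λ w → (replicate l a ++ b ∷ w) ⋆ʷ dA (n ∸ l))
                              (sym (ListP.++-identityʳ (replicate m c))))))

    conv-dC-zero : conv dC 0 ≋ single []
    conv-dC-zero = power-zero (dC 0)

    conv-dC-suc : ∀ j → conv dC (suc j) ≋ []
    conv-dC-suc j = begin
      conv dC (suc j)
        ≈⟨ sumTo-cong (suc j) (λ k → ≡⇒≋ (cong (sgn k •_) (sym (++[]⋆ʷ (replicate k c) (dC (suc j ∸ k)))))) ⟩
      sumTo (suc j) (λ k → sgn k • ((replicate k c ++ []) ⋆ʷ dC (suc j ∸ k)))
        ≈⟨ ≋-sym (alternating-block c (suc j) []) ⟩
      alternating [] (replicate (suc j) c)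
        ≈⟨ alternating-vanishes c (replicate j c) ⟩
      [] ∎
      where open ≋-Reasoning

    power-withC : ∀ k k' X → power k (withC k' X) ≋ withC k' (power k X)
    power-withC k k' X = ≋-trans (power-sumTo k n _) (sumTo-cong n λ l →
      commute-power (sgn k) (sgn (k' + l)) (single (middle l k')) (replicate k c) X (dA (n ∸ l)))

    -- Reordering the double sum reduces conv rhs to the convolution of dC.
    conv-rhs : ∀ m → conv rhs m ≋ boundary m
    conv-rhs m = begin
      sumTo m (λ k → power k (sumTo (m ∸ k) (λ k' → withC k' (dC (m ∸ k ∸ k')))))
        ≈⟨ sumTo-cong m (λ k → ≋-trans (power-sumTo k (m ∸ k) _) (sumTo-cong (m ∸ k) λ k' →
             ≋-trans (power-withC k k' (dC (m ∸ k ∸ k')))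
                     (≡⇒≋ (cong (λ j → withC k' (power k (dC j))) (∸-swap m k k'))))) ⟩
      sumTo m (λ k → sumTo (m ∸ k) (λ k' → withC k' (power k (dC (m ∸ k' ∸ k)))))
        ≈⟨ sumTo-triangle m (λ k k' → withC k' (power k (dC (m ∸ k' ∸ k)))) ⟩
      sumTo m (λ k' → sumTo (m ∸ k') (λ k → withC k' (power k (dC (m ∸ k' ∸ k)))))
        ≈⟨ sumTo-cong m (λ k' → withC-linear k' (m ∸ k') (λ k → power k (dC (m ∸ k' ∸ k)))) ⟩
      sumTo m (λ k' → withC k' (conv dC (m ∸ k')))
        ≈⟨ sumTo-last m _ (λ k' k'<m → only-last k' (m ∸ k') (ℕP.m>n⇒m∸n≢0 k'<m)) ⟩
      withC m (conv dC (m ∸ m))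
        ≈⟨ withC-cong m (≋-trans (≡⇒≋ (cong (conv dC) (ℕP.n∸n≡0 m))) conv-dC-zero) ⟩
      boundary m ∎
      where
      open ≋-Reasoning
      ∸-swap : ∀ m k k' → m ∸ k ∸ k' ≡ m ∸ k' ∸ k
      ∸-swap m k k' = trans (ℕP.∸-+-assoc m k k')
                      (trans (cong (m ∸_) (ℕP.+-comm k k')) (sym (ℕP.∸-+-assoc m k' k)))

      only-last : ∀ k' j → j ≢ 0 → withC k' (conv dC j) ≋ []
      only-last k' zero    j≢0 = ⊥-elim (j≢0 refl)
      only-last k' (suc j) _   = ≋-trans (withC-cong k' (conv-dC-suc j))
        (sumTo-null n _ (λ l → •-cong (sgn (k' + l)) (⋆-congʳ (dA (n ∸ l)) (⋆-zeroʳ (single (middle l k'))))))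

    theorem : ∀ m → lhs m ≋ rhs m
    theorem = conv-injective (λ m → ≋-trans (conv-lhs m) (≋-sym (conv-rhs m)))

module Transfer where

  open Blocks using (_≟Z_; _⊙_; _⋆ʷ_; _⋆_; dZ; dZ-from)

  open Coefficients _≟W_ public
  open Extension {ZWord} {Word} _≟W_ using () renaming (extend-cong to extendZ-cong)
  open Extension {Word} {Word} _≟W_ using (extend-cong)
  module RespZ = Respect {ZWord} {Word} _≟Z_ _≟W_
  module RespW = Respect {Word} {Word} _≟W_ _≟W_
  module Z = Coefficients _≟Z_

  coeff≡coeffOf : ∀ p w → coeff p w ≡ coeffOf p w
  coeff≡coeffOf []            w = refl
  coeff≡coeffOf ((q , u) ∷ p) w with u ≟W w
  ... | yes _ = cong (q ℚ.+_) (coeff≡coeffOf p w)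
  ... | no  _ = coeff≡coeffOf p w

  ≋⇒≈ : ∀ {p q} → p ≋ q → p ≈ q
  ≋⇒≈ {p} {q} e w = trans (coeff≡coeffOf p w) (trans (coeffwise-eq e w) (sym (coeff≡coeffOf q w)))

  scale≡• : ∀ r p → scale r p ≡ r • p
  scale≡• r []            = refl
  scale≡• r ((s , u) ∷ p) = cong ((r ℚ.* s , u) ∷_) (scale≡• r p)

  Σ≤≡sumTo : ∀ m (f : ℕ → Poly) → Σ≤ m f ≡ sumTo m f
  Σ≤≡sumTo m f = go (λ k → k) m
    where
    go : (g : ℕ → ℕ) (m : ℕ) → sumP (List.map f (List.applyUpTo g (suc m))) ≡ sumTo m (λ k → f (g k))
    go g zero    = ListP.++-identityʳ (f (g 0))
    go g (suc m) = cong (f (g 0) ++_) (go (λ k → g (suc k)) m)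

  T : ZPoly → Poly
  T = fromZPoly

  T-++ : ∀ p q → T (p ++ q) ≡ T p ++ T q
  T-++ p q = ListP.map-++ _ p q

  T-• : ∀ r p → T (r • p) ≡ r • T p
  T-• r []            = refl
  T-• r ((s , u) ∷ p) = cong ((r ℚ.* s , toWord u) ∷_) (T-• r p)

  T-extend : ∀ (f : ZWord → ZPoly) p → T (extend f p) ≡ extend (λ u → T (f u)) p
  T-extend f []            = refl
  T-extend f ((r , u) ∷ p) = trans (T-++ (r • f u) (extend f p)) (cong₂ _++_ (T-• r (f u)) (T-extend f p))

  extend-T : ∀ {K} (f : Word → Lin K) p → extend f (T p) ≡ extend (λ u → f (toWord u)) p
  extend-T f []            = refl
  extend-T f ((r , u) ∷ p) = cong (r • f (toWord u) ++_) (extend-T f p)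

  T-sumTo : ∀ m (f : ℕ → ZPoly) → T (sumTo m f) ≡ sumTo m (λ k → T (f k))
  T-sumTo zero    f = refl
  T-sumTo (suc m) f = trans (T-++ (f 0) _) (cong (T (f 0) ++_) (T-sumTo m (λ k → f (suc k))))

  T-resp : ∀ {p q} → p Z.≋ q → T p ≋ T q
  T-resp {p} {q} e = ≋-trans (as-extend p) (≋-trans (RespZ.extend-resp (λ u → single (toWord u)) e)
                                                    (≋-sym (as-extend q)))
    where
    as-extend : ∀ p → T p ≋ extend (λ u → single (toWord u)) p
    as-extend []            = ≋-refl
    as-extend ((r , u) ∷ p) = ∷-cong (toWord u) (sym (ℚP.*-identityʳ r)) (as-extend p)

  -- toWord is inverted by the parser, so harmW computes harmZ on encoded words.
  mutual
    parseAux-toWord : ∀ n j u → parseAux n (toWord (j ∷ u)) ≡ just ((n + j) ∷ u)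
    parseAux-toWord zero    zero    u rewrite parse-toWord u = refl
    parseAux-toWord (suc n) zero    u rewrite parse-toWord u | ℕP.+-identityʳ n = refl
    parseAux-toWord zero    (suc j) u = parseAux-toWord 1 j u
    parseAux-toWord (suc n) (suc j) u rewrite parseAux-toWord (suc (suc n)) j u | ℕP.+-suc n j = refl

    parse-toWord : ∀ u → parse (toWord u) ≡ just u
    parse-toWord []      = refl
    parse-toWord (j ∷ u) = parseAux-toWord 0 j u

  harmW-toWord : ∀ u v → harmW (toWord u) (toWord v) ≡ T (harmZ u v)
  harmW-toWord u v rewrite parse-toWord u | parse-toWord v = refl

  ✱-as-extend : ∀ p q → p ✱ q ≋ extend (λ u → extend (harmW u) q) p
  ✱-as-extend []            q = ≋-refl
  ✱-as-extend ((r , u) ∷ p) q =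
    ≋-trans (≡⇒≋ (ListP.concatMap-++ _ ((r , u) ∷ []) p)) (++-cong (single-left q) (✱-as-extend p q))
    where
    cons-right : ∀ s v q → ((r , u) ∷ []) ✱ ((s , v) ∷ q) ≡ scale (r ℚ.* s) (harmW u v) ++ ((r , u) ∷ []) ✱ q
    cons-right s v q = ListP.++-assoc (scale (r ℚ.* s) (harmW u v)) _ []

    single-left : ∀ q → ((r , u) ∷ []) ✱ q ≋ r • extend (harmW u) q
    single-left []            = ≋-refl
    single-left ((s , v) ∷ q) = begin
      ((r , u) ∷ []) ✱ ((s , v) ∷ q)
        ≡⟨ cons-right s v q ⟩
      scale (r ℚ.* s) (harmW u v) ++ ((r , u) ∷ []) ✱ q
        ≈⟨ ++-cong (≋-trans (≡⇒≋ (scale≡• (r ℚ.* s) (harmW u v))) (≋-sym (•-• r s (harmW u v))))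
                   (single-left q) ⟩
      r • (s • harmW u v) ++ r • extend (harmW u) q
        ≡⟨ sym (•-++ r (s • harmW u v) (extend (harmW u) q)) ⟩
      r • extend (harmW u) ((s , v) ∷ q) ∎
      where open ≋-Reasoning

  ✱-cong : ∀ {p p' q q'} → p ≋ p' → q ≋ q' → p ✱ q ≋ p' ✱ q'
  ✱-cong {p} {p'} {q} {q'} e f =
    ≋-trans (✱-as-extend p q) (≋-trans (RespW.extend-resp (λ u → extend (harmW u) q) e)
    (≋-trans (extend-cong p' (λ u → RespW.extend-resp (harmW u) f)) (≋-sym (✱-as-extend p' q'))))

  T-⋆ : ∀ p q → T p ✱ T q ≋ T (p ⋆ q)
  T-⋆ p q = begin
    T p ✱ T q
      ≈⟨ ✱-as-extend (T p) (T q) ⟩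
    extend (λ u → extend (harmW u) (T q)) (T p)
      ≡⟨ extend-T (λ u → extend (harmW u) (T q)) p ⟩
    extend (λ u → extend (harmW (toWord u)) (T q)) p
      ≈⟨ extendZ-cong p (λ u → ≡⇒≋ (trans (extend-T (harmW (toWord u)) q)
                                   (trans (extend-≡ q (harmW-toWord u)) (sym (T-extend (harmZ u) q))))) ⟩
    extend (λ u → T (u ⋆ʷ q)) p
      ≡⟨ sym (T-extend (_⋆ʷ q) p) ⟩
    T (p ⋆ q) ∎
    where
    open ≋-Reasoning
    extend-≡ : ∀ {K K'} {f g : K → Lin K'} p → (∀ v → f v ≡ g v) → extend f p ≡ extend g p
    extend-≡ []            e = refl
    extend-≡ ((r , u) ∷ p) e = cong₂ (λ s t → r • s ++ t) (e u) (extend-≡ p e)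

  ·-distribʳ : ∀ A B P → (A ⊕ B) · P ≡ A · P ⊕ B · P
  ·-distribʳ A B P = ListP.concatMap-++ _ A B

  letter·-++ : ∀ l P Q → word (l ∷ []) · (P ++ Q) ≡ word (l ∷ []) · P ++ word (l ∷ []) · Q
  letter·-++ l []            Q = refl
  letter·-++ l ((s , v) ∷ P) Q = cong ((1ℚ ℚ.* s , l ∷ v) ∷_) (letter·-++ l P Q)

  letter·-cong : ∀ l {P Q} → P ≋ Q → word (l ∷ []) · P ≋ word (l ∷ []) · Q
  letter·-cong l {P} {Q} e = ≋-trans (as-extend P) (≋-trans (RespW.extend-resp (λ v → single (l ∷ v)) e)
                                                             (≋-sym (as-extend Q)))
    where
    as-extend : ∀ P → word (l ∷ []) · P ≋ extend (λ v → single (l ∷ v)) P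
    as-extend []            = ≋-refl
    as-extend ((s , v) ∷ P) = ∷-cong (l ∷ v) (trans (ℚP.*-identityˡ s) (sym (ℚP.*-identityʳ s))) (as-extend P)

  x·consZ : ∀ j P → word (x ∷ []) · T (consZ j P) ≋ T (consZ (suc j) P)
  x·consZ j []            = ≋-refl
  x·consZ j ((r , u) ∷ P) = ∷-cong (toWord (suc j ∷ u)) (ℚP.*-identityˡ r) (x·consZ j P)

  y·T : ∀ P → word (y ∷ []) · T P ≋ T (consZ 0 P)
  y·T []            = ≋-refl
  y·T ((r , u) ∷ P) = ∷-cong (toWord (0 ∷ u)) (ℚP.*-identityˡ r) (y·T P)

  -- Every term of d(z_{j+1} v) starts with a block z_{j+1} or a merged, longer one.
  x·dZ-from : ∀ j v → word (x ∷ []) · T (dZ-from j v) ≋ T (dZ-from (suc j) v)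
  x·dZ-from j []      = x·consZ j (single [])
  x·dZ-from j (k ∷ v) rewrite T-++ (consZ j (dZ-from k v)) (dZ-from (j ⊙ k) v)
                            | T-++ (consZ (suc j) (dZ-from k v)) (dZ-from (suc j ⊙ k) v)
                            | letter·-++ x (T (consZ j (dZ-from k v))) (T (dZ-from (j ⊙ k) v)) =
    ++-cong (x·consZ j (dZ-from k v)) (x·dZ-from (j ⊙ k) v)

  dW-cons : ∀ l k v → dW (l ∷ toWord (k ∷ v)) ≡ γL l · dW (toWord (k ∷ v))
  dW-cons x zero    v = refl
  dW-cons y zero    v = refl
  dW-cons x (suc k) v = refl
  dW-cons y (suc k) v = refl

  dW-toWord : ∀ j v → dW (toWord (j ∷ v)) ≋ T (dZ-from j v)
  dW-toWord zero    []      = ≋-refl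
  dW-toWord zero    (k ∷ v) rewrite dW-cons y k v
    | ·-distribʳ (word (x ∷ [])) (word (y ∷ [])) (dW (toWord (k ∷ v))) = begin
    word (x ∷ []) · dW (toWord (k ∷ v)) ++ word (y ∷ []) · dW (toWord (k ∷ v))
      ≈⟨ ++-cong (letter·-cong x (dW-toWord k v)) (letter·-cong y (dW-toWord k v)) ⟩
    word (x ∷ []) · T (dZ-from k v) ++ word (y ∷ []) · T (dZ-from k v)
      ≈⟨ ++-cong (x·dZ-from k v) (y·T (dZ-from k v)) ⟩
    T (dZ-from (suc k) v) ++ T (consZ 0 (dZ-from k v))
      ≈⟨ ++-comm (T (dZ-from (suc k) v)) (T (consZ 0 (dZ-from k v))) ⟩
    T (consZ 0 (dZ-from k v)) ++ T (dZ-from (suc k) v)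
      ≡⟨ sym (T-++ (consZ 0 (dZ-from k v)) (dZ-from (suc k) v)) ⟩
    T (dZ-from zero (k ∷ v)) ∎
    where open ≋-Reasoning
  dW-toWord (suc j) v rewrite dW-cons x j v =
    ≋-trans (letter·-cong x (dW-toWord j v)) (x·dZ-from j v)

  d-toWord : ∀ u → d (word (toWord u)) ≋ T (dZ u)
  d-toWord u = ≋-trans (++-identityʳ (scale 1ℚ (dW (toWord u))))
               (≋-trans (≡⇒≋ (scale≡• 1ℚ (dW (toWord u))))
               (≋-trans (1• (dW (toWord u))) (dW-T u)))
    where
    dW-T : ∀ u → dW (toWord u) ≋ T (dZ u)
    dW-T []      = ≋-refl
    dW-T (j ∷ v) = dW-toWord j v

open Transfer
open Sums _≟W_ using (sumTo-cong)
open Blocks using (_⋆_; module Proposition)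

z^≡toWord : ∀ i k → z (suc i) ^W k ≡ toWord (replicate k i)
z^≡toWord i zero    = refl
z^≡toWord i (suc k) = cong (z (suc i) ++_) (z^≡toWord i k)

toWord-++ : ∀ u v → toWord (u ++ v) ≡ toWord u ++ toWord v
toWord-++ []      v = refl
toWord-++ (j ∷ u) v = trans (cong (z (suc j) ++_) (toWord-++ u v))
                            (sym (ListP.++-assoc (z (suc j)) (toWord u) (toWord v)))

three-blocks≡toWord : ∀ i j k l m → (z (suc i) ^W l) ++ z (suc j) ++ (z (suc k) ^W m)
                                    ≡ toWord (replicate l i ++ j ∷ replicate m k)
three-blocks≡toWord i j k l m rewrite z^≡toWord i l | z^≡toWord k m | toWord-++ (replicate l i) (j ∷ replicate m k) = refl

summand : ℕ → ℕ → ℕ → ℕ → ℕ → ℕ → ℕ → Poly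
summand a b c n m k l = scale (sgn (k + l))
  ((word ((z (suc a) ^W l) ++ z (suc b) ++ (z (suc c) ^W k)) ✱ d (word (z (suc c) ^W (m ∸ k))))
     ✱ d (word (z (suc a) ^W (n ∸ l))))

summand-transfer : ∀ a b c n m k l →
  T (sgn (k + l) • ((single (Proposition.middle a b c n l k) ⋆ Proposition.dC a b c n (m ∸ k))
                      ⋆ Proposition.dA a b c n (n ∸ l)))
  ≋ summand a b c n m k l
summand-transfer a b c n m k l
  rewrite three-blocks≡toWord a b c l k | z^≡toWord c (m ∸ k) | z^≡toWord a (n ∸ l) =
  ≋-trans (≡⇒≋ (T-• (sgn (k + l)) _)) (≋-trans (•-cong (sgn (k + l)) (≋-sym (begin
    (T (single (middle l k)) ✱ d (word (toWord (replicate (m ∸ k) c)))) ✱ d (word (toWord (replicate (n ∸ l) a)))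
      ≈⟨ ✱-cong (✱-cong (≋-refl {T (single (middle l k))}) (d-toWord (replicate (m ∸ k) c)))
                (d-toWord (replicate (n ∸ l) a)) ⟩
    (T (single (middle l k)) ✱ T (dC (m ∸ k))) ✱ T (dA (n ∸ l))
      ≈⟨ ✱-cong (T-⋆ (single (middle l k)) (dC (m ∸ k))) (≋-refl {T (dA (n ∸ l))}) ⟩
    T (single (middle l k) ⋆ dC (m ∸ k)) ✱ T (dA (n ∸ l))
      ≈⟨ T-⋆ (single (middle l k) ⋆ dC (m ∸ k)) (dA (n ∸ l)) ⟩
    T ((single (middle l k) ⋆ dC (m ∸ k)) ⋆ dA (n ∸ l)) ∎)))
    (≡⇒≋ (sym (scale≡• (sgn (k + l)) _))))
  where
  open Proposition a b c n
  open ≋-Reasoning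

rhs-transfer : ∀ a b c n m →
  T (Proposition.rhs a b c n m) ≋ Σ≤ m (λ k → Σ≤ n (λ l → summand a b c n m k l))
rhs-transfer a b c n m =
  ≋-trans (≡⇒≋ (T-sumTo m _))
  (≋-trans (sumTo-cong m λ k → ≋-trans (≡⇒≋ (T-sumTo n _))
             (≋-trans (sumTo-cong n (summand-transfer a b c n m k)) (≡⇒≋ (sym (Σ≤≡sumTo n _)))))
  (≡⇒≋ (sym (Σ≤≡sumTo m _))))

proposition2p4 : (a b c : ℕ) → 1 ≤ a → 1 ≤ b → 1 ≤ c → (m n : ℕ) →
    d (word ((z c ^W m) ++ z b ++ (z a ^W n)))
      ≈ Σ≤ m (λ k → Σ≤ n (λ l →
          scale (sgn (k + l))
            ((word ((z a ^W l) ++ z b ++ (z c ^W k)) ✱ d (word (z c ^W (m ∸ k))))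
               ✱ d (word (z a ^W (n ∸ l))))))
proposition2p4 (suc a) (suc b) (suc c) (s≤s z≤n) (s≤s z≤n) (s≤s z≤n) m n = ≋⇒≈ (begin
  d (word ((z (suc c) ^W m) ++ z (suc b) ++ (z (suc a) ^W n)))
    ≡⟨ cong (λ w → d (word w)) (three-blocks≡toWord c b a m n) ⟩
  d (word (toWord (replicate m c ++ b ∷ replicate n a)))
    ≈⟨ d-toWord (replicate m c ++ b ∷ replicate n a) ⟩
  T (lhs m)
    ≈⟨ T-resp (theorem m) ⟩
  T (rhs m)
    ≈⟨ rhs-transfer a b c n m ⟩
  Σ≤ m (λ k → Σ≤ n (λ l → summand a b c n m k l)) ∎)
  where
  open Proposition a b c n
  open ≋-Reasoning
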